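{- Let $K$ be a field, $I\subseteq\mathbb Z[T_1,\dots,T_n]$ an ideal, and $\mathbb A=K[T_1,\dots,T_n]/\hat I$, where $\hat I$ is the ideal generated by $I$. Then every $\mathbb A$-module $N$ embeds (as an $\mathbb A$-module) into an $\mathbb A$-module $M'$ satisfying: (i) for every $f_1,\dots,f_m\in\mathbb A$ and $u_1,\dots,u_m\in M'$ such that $\sum t_if_i=0$ implies $\sum t_iu_i=0$ for all $t_1,\dots,t_m\in\mathbb A$, there is $v\in M'$ with $f_iv=u_i$ for all $i$; and (ii) for every $f_1,\dots,f_m,g_1,\dots,g_k\in\mathbb A$ such that no $g_i$ lies in the ideal generated by the $f_j$, and all finite-dimensional $K$-subspaces $U_1,\dots,U_k\subseteq M'$, there is $v\in M'$ with $f_jv=0$ for all $j$ and $g_iv\notin U_i$ for all $i$.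
   Context: Conditions (i) and (ii) together are equivalent to the solvability axiom scheme of the paper's theory $\tilde{\mathfrak T}$: for all $f_i,g_i,v_i$ with the stated compatibility conditions, the system $f_ix=v_i$, $g_ix\notin U_i$ has a solution. -}

module Defs where

open import Level using (Level; _⊔_)
open import Data.Nat using (ℕ)
open import Data.Fin using (Fin)
open import Data.Empty using (⊥; ⊥-elim)
open import Data.Product using (Σ; Σ-syntax; ∃; _×_; _,_)
open import Relation.Nullary using (¬_)
open import Algebra.Bundles using (CommutativeRing)
open import Algebra.Structures using (IsCommutativeRing; IsRing; IsAbelianGroup; IsGroup; IsMonoid; IsSemigroup; IsMagma)
open import Algebra.Module.Bundles using (Module)
import Algebra.Definitions.RawMonoid as RawMonoidDefs
open import Relation.Binary.Structures using (IsEquivalence)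

private variable a c ℓ ℓI r : Level

record Field (c ℓ : Level) : Set (Level.suc (c ⊔ ℓ)) where
  field
    commutativeRing : CommutativeRing c ℓ
  open CommutativeRing commutativeRing public
  field
    0≉1     : ¬ (0# ≈ 1#)
    inverse : ∀ x → ¬ (x ≈ 0#) → Σ[ y ∈ Carrier ] (x * y ≈ 1#)

infixl 6 _⊕_
infixl 7 _⊗_

data Expr (A : Set a) (n : ℕ) : Set a where
  con  : A → Expr A n
  var  : Fin n → Expr A n
  0#   : Expr A n
  1#   : Expr A n
  _⊕_  : Expr A n → Expr A n → Expr A n
  _⊗_  : Expr A n → Expr A n → Expr A n
  ⊝_   : Expr A n → Expr A n

-- Quotienting Expr by it gives the commutative ring
-- freely generated by the variables and the constants subject to R.
data RingCong {A : Set a} {n : ℕ} (R : Expr A n → Expr A n → Set r)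
     : Expr A n → Expr A n → Set (a ⊔ r) where
  gen     : ∀ {x y} → R x y → RingCong R x y
  refl    : ∀ {x} → RingCong R x x
  sym     : ∀ {x y} → RingCong R x y → RingCong R y x
  trans   : ∀ {x y z} → RingCong R x y → RingCong R y z → RingCong R x z
  ⊕-cong  : ∀ {x y u v} → RingCong R x y → RingCong R u v → RingCong R (x ⊕ u) (y ⊕ v)
  ⊗-cong  : ∀ {x y u v} → RingCong R x y → RingCong R u v → RingCong R (x ⊗ u) (y ⊗ v)
  ⊝-cong  : ∀ {x y} → RingCong R x y → RingCong R (⊝ x) (⊝ y)
  ⊕-assoc : ∀ x y z → RingCong R ((x ⊕ y) ⊕ z) (x ⊕ (y ⊕ z))
  ⊕-comm  : ∀ x y → RingCong R (x ⊕ y) (y ⊕ x)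
  ⊕-idˡ   : ∀ x → RingCong R (0# ⊕ x) x
  ⊕-idʳ   : ∀ x → RingCong R (x ⊕ 0#) x
  ⊝-invˡ  : ∀ x → RingCong R ((⊝ x) ⊕ x) 0#
  ⊝-invʳ  : ∀ x → RingCong R (x ⊕ (⊝ x)) 0#
  ⊗-assoc : ∀ x y z → RingCong R ((x ⊗ y) ⊗ z) (x ⊗ (y ⊗ z))
  ⊗-comm  : ∀ x y → RingCong R (x ⊗ y) (y ⊗ x)
  ⊗-idˡ   : ∀ x → RingCong R (1# ⊗ x) x
  ⊗-idʳ   : ∀ x → RingCong R (x ⊗ 1#) x
  distribˡ : ∀ x y z → RingCong R (x ⊗ (y ⊕ z)) ((x ⊗ y) ⊕ (x ⊗ z))
  distribʳ : ∀ x y z → RingCong R ((y ⊕ z) ⊗ x) ((y ⊗ x) ⊕ (z ⊗ x))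

exprRing : (A : Set a) (n : ℕ) (R : Expr A n → Expr A n → Set r)
         → CommutativeRing a (a ⊔ r)
exprRing A n R = record
  { Carrier = Expr A n
  ; _≈_ = RingCong R
  ; _+_ = _⊕_
  ; _*_ = _⊗_
  ; -_ = ⊝_
  ; 0# = 0#
  ; 1# = 1#
  ; isCommutativeRing = record
    { isRing = record
      { +-isAbelianGroup = record
        { isGroup = record
          { isMonoid = record
            { isSemigroup = record
              { isMagma = record
                { isEquivalence = record { refl = refl ; sym = sym ; trans = trans }
                ; ∙-cong = ⊕-cong }
              ; assoc = ⊕-assoc }
            ; identity = ⊕-idˡ , ⊕-idʳ }
          ; inverse = ⊝-invˡ , ⊝-invʳ
          ; ⁻¹-cong = ⊝-cong }
        ; comm = ⊕-comm }
      ; *-cong = ⊗-cong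
      ; *-assoc = ⊗-assoc
      ; *-identity = ⊗-idˡ , ⊗-idʳ
      ; distrib = distribˡ , distribʳ }
    ; *-comm = ⊗-comm }
  }

-- ℤ[T₁,…,Tₙ]: the free commutative ring on n variables (no constants;
-- integers arise from 1# by ⊕ and ⊝).

NoRel : {A : Set a} {n : ℕ} → Expr A n → Expr A n → Set
NoRel _ _ = ⊥

ZPoly : ℕ → Set
ZPoly n = Expr ⊥ n

ℤ[T] : ℕ → CommutativeRing Level.zero Level.zero
ℤ[T] n = exprRing ⊥ n NoRel

record IsIdeal {n : ℕ} (I : ZPoly n → Set ℓI) : Set ℓI where
  open CommutativeRing (ℤ[T] n) using (_≈_)
  field
    resp  : ∀ {p q} → p ≈ q → I p → I q
    zero∈ : I 0#
    +∈    : ∀ {p q} → I p → I q → I (p ⊕ q)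
    *∈    : ∀ r {p} → I p → I (r ⊗ p)

embed : {A : Set a} {n : ℕ} → ZPoly n → Expr A n
embed (con ())
embed (var i) = var i
embed 0#      = 0#
embed 1#      = 1#
embed (p ⊕ q) = embed p ⊕ embed q
embed (p ⊗ q) = embed p ⊗ embed q
embed (⊝ p)   = ⊝ embed p

-- 𝔸 = K[T₁,…,Tₙ] / Î : expressions with constants from K, where `con`
-- is a ring homomorphism K → K[T] (so the expressions modulo ring laws
-- form K[T]), and additionally every p ∈ I is identified with 0.

module _ {c ℓ : Level} (K : Field c ℓ) (n : ℕ) where
  private module K = Field K

  data 𝔸Rel (I : ZPoly n → Set ℓI) : Expr K.Carrier n → Expr K.Carrier n → Set (c ⊔ ℓ ⊔ ℓI) where
    con-≈ : ∀ {x y} → x K.≈ y → 𝔸Rel I (con x) (con y)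
    con-+ : ∀ x y → 𝔸Rel I (con (x K.+ y)) (con x ⊕ con y)
    con-* : ∀ x y → 𝔸Rel I (con (x K.* y)) (con x ⊗ con y)
    con-1 : 𝔸Rel I (con K.1#) 1#
    in-I  : ∀ p → I p → 𝔸Rel I (embed p) 0#

  𝔸 : (I : ZPoly n → Set ℓI) → CommutativeRing c (c ⊔ ℓ ⊔ ℓI)
  𝔸 I = exprRing K.Carrier n (𝔸Rel I)

  ι : {I : ZPoly n → Set ℓI} → K.Carrier → CommutativeRing.Carrier (𝔸 I)
  ι x = con x

  module _ {I : ZPoly n → Set ℓI} {m ℓm : Level} (M : Module (𝔸 I) m ℓm) where
    open CommutativeRing (𝔸 I) using (_≈_; _*_) renaming (Carrier to A; +-rawMonoid to A+)
    open Module M using (Carrierᴹ; _≈ᴹ_; _*ₗ_; 0ᴹ; +ᴹ-rawMonoid)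
    private
      module SA = RawMonoidDefs A+
      module SM = RawMonoidDefs +ᴹ-rawMonoid

    InIdeal : {k : ℕ} → (Fin k → A) → A → Set (c ⊔ ℓ ⊔ ℓI)
    InIdeal {k} f g = Σ[ a ∈ (Fin k → A) ] (g ≈ SA.sum (λ j → a j * f j))

    InSpan : {d : ℕ} → (Fin d → Carrierᴹ) → Carrierᴹ → Set (c ⊔ ℓm)
    InSpan {d} w x = Σ[ λs ∈ (Fin d → K.Carrier) ] (x ≈ᴹ SM.sum (λ j → ι {I = I} (λs j) *ₗ w j))

    CondI : Set (c ⊔ ℓ ⊔ ℓI ⊔ m ⊔ ℓm)
    CondI = ∀ (k : ℕ) (f : Fin k → A) (u : Fin k → Carrierᴹ)
          → (∀ (t : Fin k → A) → SA.sum (λ i → t i * f i) ≈ CommutativeRing.0# (𝔸 I)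
                                → SM.sum (λ i → t i *ₗ u i) ≈ᴹ 0ᴹ)
          → Σ[ v ∈ Carrierᴹ ] (∀ i → f i *ₗ v ≈ᴹ u i)

    -- Condition (ii).  A finite-dimensional K-subspace is given as the
    -- span of a finite family of vectors (e.g. a basis).
    CondII : Set (c ⊔ ℓ ⊔ ℓI ⊔ m ⊔ ℓm)
    CondII = ∀ (k : ℕ) (f : Fin k → A) (l : ℕ) (g : Fin l → A)
           → (∀ i → ¬ InIdeal f (g i))
           → (d : Fin l → ℕ) (U : (i : Fin l) → Fin (d i) → Carrierᴹ)
           → Σ[ v ∈ Carrierᴹ ] ((∀ j → f j *ₗ v ≈ᴹ 0ᴹ) × (∀ i → ¬ InSpan (U i) (g i *ₗ v)))

{-# OPTIONS --safe #-}
-- Let N⁺ be N with a new generator x_σ adjoined for every compatible system σ : fᵢ·v = uᵢ over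
-- N, subject only to the relations fᵢ·x_σ = uᵢ, and let M′ be the union of N ⊆ N⁺ ⊆ N⁺⁺ ⊆ ⋯.
-- Compatibility says that Σ tᵢfᵢ ↦ Σ tᵢuᵢ is a well-defined map from the ideal (f) to N, and this
-- is exactly what makes N → N⁺ injective.  Finitely many elements of M′ lie in one stage, so every
-- system over M′ is solved by some x_σ, which gives (i).  For (ii) take σ = (f, 0) over a stage
-- containing the Uᵢ: the relations only ever rewrite multiples of x_σ by elements of (f), so
-- gᵢ·x_σ does not even lie in that stage when gᵢ ∉ (f).  Nothing about K or I is used.

module Submission where

open import Defs using (Field; ZPoly; IsIdeal; 𝔸; CondI; CondII; ι)
open import Level using (Level; _⊔_)
open import Data.Nat.Base using (ℕ; zero; suc; _≤′_; ≤′-refl; ≤′-step; ≤′-reflexive)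
  renaming (_+_ to _+ℕ_; _⊔_ to _⊔ℕ_)
open import Data.Nat.Properties
  using (≤′-trans; ≤⇒≤′; ≤′⇒≤; m≤m⊔n; m≤n⊔m; 1+n≰n; ≡-irrelevant; z≤′n)
open import Data.Fin.Base using (Fin; zero; suc; _↑ˡ_; _↑ʳ_; splitAt)
open import Data.Fin.Properties using (_≟_; splitAt-↑ˡ; splitAt-↑ʳ; ↑ʳ-injective)
open import Data.Vec.Functional using (Vector; []; _∷_; _++_; map; zipWith; tail)
open import Data.Vec.Functional.Properties using (lookup-++ˡ; lookup-++ʳ)
open import Data.Vec.Functional.Relation.Binary.Pointwise.Properties using (++⁺)
open import Data.Product.Base using (Σ; Σ-syntax; _×_; _,_)
open import Data.Sum.Base using (_⊎_; inj₁; inj₂)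
import Data.Sum.Base as Sum
open import Data.Sum.Properties using ([,]-map; [,]-∘)
open import Function.Base using (_∘_; id; flip)
open import Relation.Nullary using (¬_; yes; no; contradiction)
open import Relation.Binary.PropositionalEquality as ≡ using (_≡_; _≢_; _≗_)
open import Algebra.Bundles using (Monoid; CommutativeMonoid; AbelianGroup; CommutativeRing)
open import Algebra.Module.Bundles using (Module)
open import Algebra.Module.Structures.Biased using (IsModuleFromLeft)
open import Algebra.Module.Morphism.Structures using (module ModuleMorphisms)
open ModuleMorphisms using (IsModuleMonomorphism)
import Algebra.Module.Morphism.Construct.Composition as Composition
import Algebra.Module.Morphism.Construct.Identity as Identity
import Algebra.Properties.Monoid.Sum as MonoidSum
import Algebra.Properties.CommutativeMonoid.Sum as CommutativeMonoidSum
import Algebra.Properties.Semiring.Sum as SemiringSum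
import Algebra.Properties.AbelianGroup

↑-elim : ∀ {p} {m n} (P : Fin (m +ℕ n) → Set p) →
         (∀ i → P (i ↑ˡ n)) → (∀ j → P (m ↑ʳ j)) → ∀ k → P k
↑-elim {m = zero}  P left right k       = right k
↑-elim {m = suc m} P left right zero    = left zero
↑-elim {m = suc m} P left right (suc k) = ↑-elim (P ∘ suc) (left ∘ suc) right k

↑ˡ≢↑ʳ : ∀ {m n} (i : Fin m) (j : Fin n) → ¬ (i ↑ˡ n ≡ m ↑ʳ j)
↑ˡ≢↑ʳ {m} {n} i j eq
  with ≡.trans (≡.sym (splitAt-↑ˡ m i n)) (≡.trans (≡.cong (splitAt m) eq) (splitAt-↑ʳ m n j))
... | ()

module _ {a} {A : Set a} where

  tail-++ : ∀ {m n} (xs : Vector A (suc m)) (ys : Vector A n) → tail (xs ++ ys) ≗ tail xs ++ ys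
  tail-++ {m} xs ys i = [,]-map (splitAt m i)

  map-++ : ∀ {b} {B : Set b} (f : A → B) {m n} (xs : Vector A m) (ys : Vector A n) →
           map f (xs ++ ys) ≗ map f xs ++ map f ys
  map-++ f {m} xs ys i = [,]-∘ f (splitAt m i)

  zipWith-++ : ∀ {b c} {B : Set b} {C : Set c} (f : A → B → C) {m n}
               (xs : Vector A m) (ys : Vector A n) (xs′ : Vector B m) (ys′ : Vector B n) →
               zipWith f (xs ++ ys) (xs′ ++ ys′) ≗ zipWith f xs xs′ ++ zipWith f ys ys′
  zipWith-++ f {m} xs ys xs′ ys′ i with splitAt m i
  ... | inj₁ _ = ≡.refl
  ... | inj₂ _ = ≡.refl

module _ {a b ℓa ℓb} (A : Monoid a ℓa) (B : Monoid b ℓb) where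
  private
    module A = Monoid A
    module B = Monoid B
    module ΣA = MonoidSum A
    module ΣB = MonoidSum B

  sum-homo : {h : A.Carrier → B.Carrier} →
             (∀ x y → h (x A.∙ y) B.≈ h x B.∙ h y) → h A.ε B.≈ B.ε →
             ∀ {n} (xs : Vector A.Carrier n) → h (ΣA.sum xs) B.≈ ΣB.sum (map h xs)
  sum-homo h-∙ h-ε {zero}  xs = h-ε
  sum-homo h-∙ h-ε {suc n} xs = B.trans (h-∙ _ _) (B.∙-congˡ (sum-homo h-∙ h-ε (tail xs)))

module _ {a ℓ} (G : Monoid a ℓ) where
  open Monoid G
  open MonoidSum G

  sum-++ : ∀ {m n} (xs : Vector Carrier m) (ys : Vector Carrier n) → sum (xs ++ ys) ≈ sum xs ∙ sum ys
  sum-++ {zero}  xs ys = sym (identityˡ _)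
  sum-++ {suc m} xs ys = begin
    xs zero ∙ sum (tail (xs ++ ys))     ≡⟨ ≡.cong (λ s → xs zero ∙ s) (sum-cong-≗ (tail-++ xs ys)) ⟩
    xs zero ∙ sum (tail xs ++ ys)       ≈⟨ ∙-congˡ (sum-++ (tail xs) ys) ⟩
    xs zero ∙ (sum (tail xs) ∙ sum ys)  ≈⟨ assoc _ _ _ ⟨
    sum xs ∙ sum ys                     ∎
    where open import Relation.Binary.Reasoning.Setoid setoid

  sum-zero : ∀ {n} {xs : Vector Carrier n} → (∀ i → xs i ≈ ε) → sum xs ≈ ε
  sum-zero {zero}  zeros = refl
  sum-zero {suc n} zeros = trans (∙-cong (zeros zero) (sum-zero (zeros ∘ suc))) (identityˡ ε)

module _ {a ℓ} (G : AbelianGroup a ℓ) where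
  open AbelianGroup G
  open import Relation.Binary.Reasoning.Setoid setoid
  open import Algebra.Properties.AbelianGroup G using (⁻¹-∙-comm)

  [x-y]∙[y-z]≈x-z : ∀ x y z → (x - y) ∙ (y - z) ≈ x - z
  [x-y]∙[y-z]≈x-z x y z = begin
    (x - y) ∙ (y - z)      ≈⟨ assoc x (y ⁻¹) (y - z) ⟩
    x ∙ (y ⁻¹ ∙ (y - z))   ≈⟨ ∙-congˡ (assoc (y ⁻¹) y (z ⁻¹)) ⟨
    x ∙ (y ⁻¹ ∙ y ∙ z ⁻¹)  ≈⟨ ∙-congˡ (∙-congʳ (inverseˡ y)) ⟩
    x ∙ (ε ∙ z ⁻¹)         ≈⟨ ∙-congˡ (identityˡ (z ⁻¹)) ⟩
    x - z                  ∎

  [x-y]∙[u-v]≈[x∙u]-[y∙v] : ∀ x y u v → (x - y) ∙ (u - v) ≈ (x ∙ u) - (y ∙ v)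
  [x-y]∙[u-v]≈[x∙u]-[y∙v] x y u v = begin
    (x - y) ∙ (u - v)         ≈⟨ interchange x (y ⁻¹) u (v ⁻¹) ⟩
    (x ∙ u) ∙ (y ⁻¹ ∙ v ⁻¹)   ≈⟨ ∙-congˡ (⁻¹-∙-comm y v) ⟩
    (x ∙ u) - (y ∙ v)         ∎
    where open import Algebra.Properties.CommutativeSemigroup commutativeSemigroup using (interchange)

module Pushforward {a ℓ} (G : CommutativeMonoid a ℓ) where
  open CommutativeMonoid G renaming (_∙_ to _+_; ε to 0#; ∙-cong to +-cong; ∙-congˡ to +-congˡ)
  open CommutativeMonoidSum G using (sum; sum-cong-≋; sum-cong-≗; ∑-distrib-+; ∑-comm)
  open import Relation.Binary.Reasoning.Setoid setoid

  place : ∀ {n} → Fin n → Carrier → Vector Carrier n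
  place p x q with p ≟ q
  ... | yes _ = x
  ... | no  _ = 0#

  push : ∀ {m n} → (Fin m → Fin n) → Vector Carrier m → Vector Carrier n
  push β c q = sum (λ j → place (β j) (c j) q)

  module _ {n} (p q : Fin n) where

    place-cong : ∀ {x y} → x ≈ y → place p x q ≈ place p y q
    place-cong x≈y with p ≟ q
    ... | yes _ = x≈y
    ... | no  _ = refl

    place-0 : place p 0# q ≈ 0#
    place-0 with p ≟ q
    ... | yes _ = refl
    ... | no  _ = refl

    place-+ : ∀ x y → place p (x + y) q ≈ place p x q + place p y q
    place-+ x y with p ≟ q
    ... | yes _ = refl
    ... | no  _ = sym (identityˡ 0#)

    place-homo : ∀ {h : Carrier → Carrier} → h 0# ≈ 0# → ∀ x → place p (h x) q ≈ h (place p x q)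
    place-homo h-0 x with p ≟ q
    ... | yes _ = refl
    ... | no  _ = sym h-0

    place-sum : ∀ {k} (xs : Vector Carrier k) → place p (sum xs) q ≈ sum (λ i → place p (xs i) q)
    place-sum = sum-homo monoid monoid place-+ place-0

  place-suc : ∀ {n} (p q : Fin n) x → place (suc p) x (suc q) ≡ place p x q
  place-suc p q x with p ≟ q
  ... | yes _ = ≡.refl
  ... | no  _ = ≡.refl

  sum-place : ∀ {n} (p : Fin n) x → sum (place p x) ≈ x
  sum-place {suc n} zero    x = trans (+-congˡ (sum-zero monoid {n} (λ q → refl))) (identityʳ x)
  sum-place {suc n} (suc p) x =
    trans (+-congˡ (trans (reflexive (sum-cong-≗ (λ q → place-suc p q x))) (sum-place p x))) (identityˡ x)

  place-≢ : ∀ {n} {p q : Fin n} x → p ≢ q → place p x q ≈ 0#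
  place-≢ {p = p} {q} x p≢q with p ≟ q
  ... | yes p≡q = contradiction p≡q p≢q
  ... | no  _   = refl

  place-⊎ : ∀ {b} {B : Set b} {n} (p q : Fin n) {x} → (p ≡ q → x ≈ 0# ⊎ B) → place p x q ≈ 0# ⊎ B
  place-⊎ p q onDiagonal with p ≟ q
  ... | yes p≡q = onDiagonal p≡q
  ... | no  _   = inj₁ refl

  sum-⊎ : ∀ {b} {B : Set b} {n} {xs : Vector Carrier n} → (∀ i → xs i ≈ 0# ⊎ B) → sum xs ≈ 0# ⊎ B
  sum-⊎ {n = zero}  each = inj₁ refl
  sum-⊎ {n = suc n} each with each zero | sum-⊎ (each ∘ suc)
  ... | inj₂ b  | _       = inj₂ b
  ... | inj₁ _  | inj₂ b  = inj₂ b
  ... | inj₁ x≈0 | inj₁ s≈0 = inj₁ (trans (+-cong x≈0 s≈0) (identityˡ 0#))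

  module _ {m n} (β : Fin m → Fin n) where

    push-cong : ∀ {c d : Vector Carrier m} → (∀ j → c j ≈ d j) → ∀ q → push β c q ≈ push β d q
    push-cong c≈d q = sum-cong-≋ (λ j → place-cong (β j) q (c≈d j))

    push-homo : ∀ {h : Carrier → Carrier} → (∀ x y → h (x + y) ≈ h x + h y) → h 0# ≈ 0# →
                ∀ c q → push β (map h c) q ≈ h (push β c q)
    push-homo {h} h-+ h-0 c q =
      trans (sum-cong-≋ (λ j → place-homo (β j) q {h} h-0 (c j)))
            (sym (sum-homo monoid monoid h-+ h-0 (λ j → place (β j) (c j) q)))

    push-+ : ∀ c d q → push β (λ j → c j + d j) q ≈ push β c q + push β d q
    push-+ c d q = trans (sum-cong-≋ (λ j → place-+ (β j) q (c j) (d j)))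
                         (∑-distrib-+ (λ j → place (β j) (c j) q) (λ j → place (β j) (d j) q))

    sum-push : ∀ c → sum (push β c) ≈ sum c
    sum-push c = begin
      sum (λ q → sum (λ j → place (β j) (c j) q))  ≈⟨ ∑-comm (λ j q → place (β j) (c j) q) ⟨
      sum (λ j → sum (place (β j) (c j)))          ≈⟨ sum-cong-≋ (λ j → sum-place (β j) (c j)) ⟩
      sum c                                        ∎

    push-sum : ∀ {k} (w : Fin m → Vector Carrier k) q →
               sum (λ i → push β (λ j → w j i) q) ≈ push β (λ j → sum (w j)) q
    push-sum w q = begin
      sum (λ i → sum (λ j → place (β j) (w j i) q))  ≈⟨ ∑-comm (λ j i → place (β j) (w j i) q) ⟨
      sum (λ j → sum (λ i → place (β j) (w j i) q))  ≈⟨ sum-cong-≋ (λ j → place-sum (β j) q (w j)) ⟨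
      push β (λ j → sum (w j)) q                     ∎

    push-⊎ : ∀ {b} {B : Set b} {c : Vector Carrier m} q →
             (∀ j → β j ≡ q → c j ≈ 0# ⊎ B) → push β c q ≈ 0# ⊎ B
    push-⊎ q onFibre = sum-⊎ (λ j → place-⊎ (β j) q (onFibre j))

    push-miss : ∀ c q → (∀ j → β j ≢ q) → push β c q ≈ 0#
    push-miss c q missed = sum-zero monoid {m} (λ j → place-≢ (c j) (missed j))

  push-id : ∀ {n} (c : Vector Carrier n) q → push id c q ≈ c q
  push-id {suc n} c zero    = trans (+-congˡ (sum-zero monoid {n} (λ _ → refl))) (identityʳ (c zero))
  push-id {suc n} c (suc q) = trans (+-congˡ (trans (reflexive (sum-cong-≗ (λ j → place-suc j q (c (suc j)))))
                                                    (push-id (c ∘ suc) q)))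
                                    (identityˡ (c (suc q)))

  push-hit : ∀ {m n} (β : Fin m → Fin n) → (∀ {i j} → β i ≡ β j → i ≡ j) →
             ∀ c i → push β c (β i) ≈ c i
  push-hit β β-injective c i = trans (reflexive (sum-cong-≗ placeAlong)) (push-id c i)
    where
    placeAlong : ∀ j → place (β j) (c j) (β i) ≡ place j (c j) i
    placeAlong j with β j ≟ β i | j ≟ i
    ... | yes _     | yes _   = ≡.refl
    ... | no  _     | no  _   = ≡.refl
    ... | yes βj≡βi | no  j≢i = contradiction (β-injective βj≡βi) j≢i
    ... | no  βj≢βi | yes j≡i = contradiction (≡.cong β j≡i) βj≢βi

  push-++ : ∀ {m m′ n} (α : Fin m → Fin n) (β : Fin m′ → Fin n) c d q →
            push (α ++ β) (c ++ d) q ≈ push α c q + push β d q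
  push-++ α β c d q = trans (reflexive (sum-cong-≗ (zipWith-++ (λ p x → place p x q) α β c d)))
                            (sum-++ monoid (λ j → place (α j) (c j) q) (λ j → place (β j) (d j) q))

module _ {s} {S : Set s} where

  infix 4 _⇒_
  record _⇒_ {m n} (A : Vector S m) (B : Vector S n) : Set s where
    field
      index     : Fin m → Fin n
      preserves : ∀ j → A j ≡ B (index j)
  open _⇒_ public

  id⇒ : ∀ {m} {A : Vector S m} → A ⇒ A
  id⇒ = record { index = id ; preserves = λ _ → ≡.refl }

  module _ {m n} {A : Vector S m} {B : Vector S n} where

    inl⇒ : A ⇒ A ++ B
    inl⇒ = record { index = _↑ˡ n ; preserves = λ j → ≡.sym (lookup-++ˡ A B j) }

    inr⇒ : B ⇒ A ++ B
    inr⇒ = record { index = m ↑ʳ_ ; preserves = λ j → ≡.sym (lookup-++ʳ A B j) }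

    module _ {k} {C : Vector S k} where

      infixr 9 _∘⇒_
      _∘⇒_ : B ⇒ C → A ⇒ B → A ⇒ C
      β ∘⇒ α = record
        { index = index β ∘ index α ; preserves = λ j → ≡.trans (preserves α j) (preserves β (index α j)) }

      [_,_]⇒ : A ⇒ C → B ⇒ C → A ++ B ⇒ C
      [ α , β ]⇒ = record
        { index = index α ++ index β ; preserves = ++⁺ (λ σ q → σ ≡ C q) (preserves α) (preserves β) }

  []⇒ : ∀ {n} {B : Vector S n} → [] ⇒ B
  []⇒ = record { index = λ () ; preserves = λ () }

module _ {r ℓr} (R : CommutativeRing r ℓr) where
  open CommutativeRing R
  open SemiringSum semiring using (sum)

  InIdeal : ∀ {k} → Vector Carrier k → Carrier → Set (r ⊔ ℓr)
  InIdeal {k} f x = Σ[ t ∈ Vector Carrier k ] x ≈ sum (λ i → t i * f i)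

module _ {r ℓr a ℓa} {R : CommutativeRing r ℓr} (M : Module R a ℓa) where
  open CommutativeRing R
  open Module M
  open SemiringSum semiring using (sum)
  open CommutativeMonoidSum +ᴹ-commutativeMonoid using () renaming (sum to sumᴹ)

  Compatible : ∀ {k} → Vector Carrier k → Vector Carrierᴹ k → Set (r ⊔ ℓr ⊔ ℓa)
  Compatible {k} f u =
    ∀ (t : Vector Carrier k) → sum (λ i → t i * f i) ≈ 0# → sumᴹ (λ i → t i *ₗ u i) ≈ᴹ 0ᴹ

  InSpan : ∀ {d} → Vector Carrierᴹ d → Carrierᴹ → Set (r ⊔ ℓa)
  InSpan {d} w x = Σ[ c ∈ Vector Carrier d ] x ≈ᴹ sumᴹ (λ j → c j *ₗ w j)

  -- Conditions (i) and (ii); in (ii) the Uᵢ are spanned over R rather than over K, which is stronger.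
  SolvesCompatibleSystems : Set (r ⊔ ℓr ⊔ a ⊔ ℓa)
  SolvesCompatibleSystems = ∀ k (f : Vector Carrier k) (u : Vector Carrierᴹ k) →
    Compatible f u → Σ[ v ∈ Carrierᴹ ] (∀ i → f i *ₗ v ≈ᴹ u i)

  HasGenericAnnihilatedElements : Set (r ⊔ ℓr ⊔ a ⊔ ℓa)
  HasGenericAnnihilatedElements =
    ∀ k (f : Vector Carrier k) l (g : Vector Carrier l) → (∀ i → ¬ InIdeal R f (g i)) →
    (d : Fin l → ℕ) (U : (i : Fin l) → Vector Carrierᴹ (d i)) →
    Σ[ v ∈ Carrierᴹ ] ((∀ j → f j *ₗ v ≈ᴹ 0ᴹ) × (∀ i → ¬ InSpan (U i) (g i *ₗ v)))

-- Adjoining solutions of all compatible systems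

module AdjoinSolutions {r ℓr a ℓa} {R : CommutativeRing r ℓr} (M : Module R a ℓa) where
  open CommutativeRing R hiding (zero)
  open Module M
  open SemiringSum semiring using (sum; sum-cong-≋; *-distribˡ-sum)
  private
    module ΣM = CommutativeMonoidSum +ᴹ-commutativeMonoid
    module PushR = Pushforward +-commutativeMonoid
    module PushM = Pushforward +ᴹ-commutativeMonoid
    module +R = Algebra.Properties.AbelianGroup +-abelianGroup
    module +ᴹG = Algebra.Properties.AbelianGroup +ᴹ-abelianGroup
  open ΣM using () renaming (sum to sumᴹ; sum-cong-≋ to sumᴹ-cong-≋)
  open PushR using (push)

  L : Level
  L = r ⊔ ℓr ⊔ a ⊔ ℓa

  record System : Set L where
    field
      {size}     : ℕ
      lhs        : Vector Carrier size
      rhs        : Vector Carrierᴹ size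
      compatible : Compatible M lhs rhs
  open System

  -- The graph of the map Σ tᵢfᵢ ↦ Σ tᵢuᵢ on the ideal (lhs σ), well defined by compatibility.
  record Graph (σ : System) (x : Carrier) (y : Carrierᴹ) : Set (r ⊔ ℓr ⊔ ℓa) where
    constructor graph
    field
      multipliers : Vector Carrier (size σ)
      source      : x ≈ sum (λ i → multipliers i * lhs σ i)
      target      : y ≈ᴹ sumᴹ (λ i → multipliers i *ₗ rhs σ i)

  module _ {σ : System} where

    graph-resp : ∀ {x x′ y y′} → x ≈ x′ → y ≈ᴹ y′ → Graph σ x y → Graph σ x′ y′
    graph-resp x≈x′ y≈y′ (graph t x≈ y≈) =
      graph t (trans (sym x≈x′) x≈) (≈ᴹ-trans (≈ᴹ-sym y≈y′) y≈)

    graph-0 : Graph σ 0# 0ᴹ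
    graph-0 = graph (λ _ → 0#)
      (sym (sum-zero +-monoid {size σ} (λ i → zeroˡ (lhs σ i))))
      (≈ᴹ-sym (sum-zero +ᴹ-monoid {size σ} (λ i → *ₗ-zeroˡ (rhs σ i))))

    graph-+ : ∀ {x x′ y y′} → Graph σ x y → Graph σ x′ y′ → Graph σ (x + x′) (y +ᴹ y′)
    graph-+ (graph t x≈ y≈) (graph t′ x′≈ y′≈) = graph (λ i → t i + t′ i)
      (trans (+-cong x≈ x′≈) (sym (trans (sum-cong-≋ (λ i → distribʳ (lhs σ i) (t i) (t′ i)))
                                         (∑-distrib-+ (λ i → t i * lhs σ i) (λ i → t′ i * lhs σ i)))))
      (≈ᴹ-trans (+ᴹ-cong y≈ y′≈) (≈ᴹ-sym (≈ᴹ-trans (sumᴹ-cong-≋ (λ i → *ₗ-distribʳ (rhs σ i) (t i) (t′ i)))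
                                                   (ΣM.∑-distrib-+ (λ i → t i *ₗ rhs σ i) (λ i → t′ i *ₗ rhs σ i)))))
      where open SemiringSum semiring using (∑-distrib-+)

    graph-* : ∀ s {x y} → Graph σ x y → Graph σ (s * x) (s *ₗ y)
    graph-* s (graph t x≈ y≈) = graph (λ i → s * t i)
      (trans (*-congˡ x≈) (trans (*-distribˡ-sum s (λ i → t i * lhs σ i))
                                 (sum-cong-≋ (λ i → sym (*-assoc s (t i) (lhs σ i))))))
      (≈ᴹ-trans (*ₗ-congˡ y≈) (≈ᴹ-trans (sum-homo +ᴹ-monoid +ᴹ-monoid (*ₗ-distribˡ s) (*ₗ-zeroʳ s) (λ i → t i *ₗ rhs σ i))
                                        (sumᴹ-cong-≋ (λ i → ≈ᴹ-sym (*ₗ-assoc s (t i) (rhs σ i))))))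

    graph-sum : ∀ {k} {xs : Vector Carrier k} {ys : Vector Carrierᴹ k} →
                (∀ i → Graph σ (xs i) (ys i)) → Graph σ (sum xs) (sumᴹ ys)
    graph-sum {zero}  each = graph-0
    graph-sum {suc k} each = graph-+ (each zero) (graph-sum (each ∘ suc))

    graph-place : ∀ {n} (p q : Fin n) {x y} → (p ≡ q → Graph σ x y) →
                  Graph σ (PushR.place p x q) (PushM.place p y q)
    graph-place p q onDiagonal with p ≟ q
    ... | yes p≡q = onDiagonal p≡q
    ... | no  _   = graph-0

    graph-target : ∀ i → Graph σ (lhs σ i) (rhs σ i)
    graph-target i = graph (λ j → PushR.place j 1# i)
      (sym (trans (sum-cong-≋ (λ j → unit-* j)) (PushR.push-id (lhs σ) i)))
      (≈ᴹ-sym (≈ᴹ-trans (sumᴹ-cong-≋ (λ j → unit-*ₗ j)) (PushM.push-id (rhs σ) i)))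
      where
      unit-* : ∀ j → PushR.place j 1# i * lhs σ j ≈ PushR.place j (lhs σ j) i
      unit-* j with j ≟ i
      ... | yes _ = *-identityˡ _
      ... | no  _ = zeroˡ _
      unit-*ₗ : ∀ j → PushR.place j 1# i *ₗ rhs σ j ≈ᴹ PushM.place j (rhs σ j) i
      unit-*ₗ j with j ≟ i
      ... | yes _ = *ₗ-identityˡ _
      ... | no  _ = *ₗ-zeroˡ _

    graph-ideal : ∀ {x y} → Graph σ x y → InIdeal R (lhs σ) x
    graph-ideal (graph t x≈ _) = t , x≈

    graph-from-0 : ∀ {y} → Graph σ 0# y → y ≈ᴹ 0ᴹ
    graph-from-0 (graph t 0≈ y≈) = ≈ᴹ-trans y≈ (compatible σ t (sym 0≈))

  graph-subst : ∀ {σ τ x y} → σ ≡ τ → Graph σ x y → Graph τ x y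
  graph-subst ≡.refl g = g

  -- Systems have no decidable equality, so the extension is not presented by normal forms.
  -- Instead y + Σⱼ coⱼ·x_{labⱼ} is zero when every coⱼ splits into weights over columns carrying
  -- the same system, each column sum is related by the Graph of its system to an image in M,
  -- and y cancels the images.
  record Witness (y : Carrierᴹ) {m} (lab : Vector System m) (co : Vector Carrier m)
                 {n} (columns : Vector System n) : Set L where
    field
      weight       : Fin m → Vector Carrier n
      weight-label : ∀ j q → weight j q ≈ 0# ⊎ lab j ≡ columns q
      row-sum      : ∀ j → co j ≈ sum (weight j)
      image        : Vector Carrierᴹ n
      column       : ∀ q → Graph (columns q) (sum (λ j → weight j q)) (image q)
      balance      : y +ᴹ sumᴹ image ≈ᴹ 0ᴹ
  open Witness

  record Vanishes (y : Carrierᴹ) {m} (lab : Vector System m) (co : Vector Carrier m) : Set L where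
    constructor vanishes
    field
      {width}   : ℕ
      {columns} : Vector System width
      witness   : Witness y lab co columns

  private
    variable
      m n n′ : ℕ
      y y′ y₁ y₂ : Carrierᴹ
      lab lab′ lab₁ lab₂ : Vector System m
      co co′ co₁ co₂ : Vector Carrier m
      cols cols₁ cols₂ : Vector System n

  witness-resp : y ≈ᴹ y′ → (∀ j → lab j ≡ lab′ j) → (∀ j → co j ≈ co′ j) →
                 Witness y lab co cols → Witness y′ lab′ co′ cols
  witness-resp y≈y′ lab≡lab′ co≈co′ W = record
    { weight       = weight W
    ; weight-label = λ j q → Sum.map₂ (≡.trans (≡.sym (lab≡lab′ j))) (weight-label W j q)
    ; row-sum      = λ j → trans (sym (co≈co′ j)) (row-sum W j)
    ; image        = image W
    ; column       = column W
    ; balance      = ≈ᴹ-trans (+ᴹ-congʳ (≈ᴹ-sym y≈y′)) (balance W)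
    }

  witness-formal : ∀ {y m} {lab : Vector System m} {co : Vector Carrier m} {n} {cols : Vector System n} →
                   y ≈ᴹ 0ᴹ → (β : lab ⇒ cols) → (∀ q → push (index β) co q ≈ 0#) → Witness y lab co cols
  witness-formal {co = co} {n = n} {cols = cols} y≈0 β vanish = record
    { weight       = λ j → PushR.place (index β j) (co j)
    ; weight-label = λ j q → PushR.place-⊎ (index β j) q (λ e → inj₂ (≡.trans (preserves β j) (≡.cong cols e)))
    ; row-sum      = λ j → sym (PushR.sum-place (index β j) (co j))
    ; image        = λ _ → 0ᴹ
    ; column       = λ q → graph-resp (sym (vanish q)) ≈ᴹ-refl graph-0
    ; balance      = ≈ᴹ-trans (+ᴹ-cong y≈0 (sum-zero +ᴹ-monoid {n} (λ _ → ≈ᴹ-refl))) (+ᴹ-identityˡ 0ᴹ)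
    }

  witness-append : ∀ {y₁ y₂} {cols : Vector System n} →
                   Witness y₁ lab₁ co₁ cols → Witness y₂ lab₂ co₂ cols →
                   Witness (y₁ +ᴹ y₂) (lab₁ ++ lab₂) (co₁ ++ co₂) cols
  witness-append {lab₁ = lab₁} {co₁ = co₁} {lab₂ = lab₂} {co₂ = co₂} {y₁ = y₁} {y₂} {cols} W₁ W₂ = record
    { weight       = weight W₁ ++ weight W₂
    ; weight-label = ++⁺ (λ σ row → ∀ q → row q ≈ 0# ⊎ σ ≡ cols q)
                         {xs = lab₁} {weight W₁} {lab₂} {weight W₂} (weight-label W₁) (weight-label W₂)
    ; row-sum      = ++⁺ (λ c row → c ≈ sum row)
                         {xs = co₁} {weight W₁} {co₂} {weight W₂} (row-sum W₁) (row-sum W₂)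
    ; image        = λ q → image W₁ q +ᴹ image W₂ q
    ; column       = λ q → graph-resp (sym (column-sum q)) ≈ᴹ-refl (graph-+ (column W₁ q) (column W₂ q))
    ; balance      = begin
        (y₁ +ᴹ y₂) +ᴹ sumᴹ (λ q → image W₁ q +ᴹ image W₂ q)  ≈⟨ +ᴹ-congˡ (ΣM.∑-distrib-+ (image W₁) (image W₂)) ⟩
        (y₁ +ᴹ y₂) +ᴹ (sumᴹ (image W₁) +ᴹ sumᴹ (image W₂))   ≈⟨ interchange y₁ y₂ _ _ ⟩
        (y₁ +ᴹ sumᴹ (image W₁)) +ᴹ (y₂ +ᴹ sumᴹ (image W₂))   ≈⟨ +ᴹ-cong (balance W₁) (balance W₂) ⟩
        0ᴹ +ᴹ 0ᴹ                                            ≈⟨ +ᴹ-identityˡ 0ᴹ ⟩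
        0ᴹ                                                  ∎
    }
    where
    open import Relation.Binary.Reasoning.Setoid ≈ᴹ-setoid
    open import Algebra.Properties.CommutativeSemigroup
      (CommutativeMonoid.commutativeSemigroup +ᴹ-commutativeMonoid) using (interchange)
    column-sum : ∀ q → sum (λ k → (weight W₁ ++ weight W₂) k q)
                       ≈ sum (λ j → weight W₁ j q) + sum (λ j → weight W₂ j q)
    column-sum q = trans (reflexive (SemiringSum.sum-cong-≗ semiring
                                      (map-++ (λ row → row q) (weight W₁) (weight W₂))))
                         (sum-++ +-monoid (λ j → weight W₁ j q) (λ j → weight W₂ j q))

  graph-push : ∀ {cols′ : Vector System n′} {x : Vector Carrier n} {z : Vector Carrierᴹ n} →
               (∀ q → Graph (cols q) (x q) (z q)) →
               (ρ : cols ⇒ cols′) → ∀ q′ → Graph (cols′ q′) (push (index ρ) x q′) (PushM.push (index ρ) z q′)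
  graph-push {cols′ = cols′} each ρ q′ = graph-sum (λ q → graph-place (index ρ q) q′
    (λ e → graph-subst (≡.trans (preserves ρ q) (≡.cong cols′ e)) (each q)))

  witness-regroup : ∀ {cols′ : Vector System n′} →
                    Witness y lab co cols → cols ⇒ cols′ → Witness y lab co cols′
  witness-regroup {cols′ = cols′} W ρ = record
    { weight       = λ j → push (index ρ) (weight W j)
    ; weight-label = λ j q′ → PushR.push-⊎ (index ρ) q′ (λ q e →
                       Sum.map₂ (λ l → ≡.trans l (≡.trans (preserves ρ q) (≡.cong cols′ e))) (weight-label W j q))
    ; row-sum      = λ j → trans (row-sum W j) (sym (PushR.sum-push (index ρ) (weight W j)))
    ; image        = PushM.push (index ρ) (image W)
    ; column       = λ q′ → graph-resp (sym (PushR.push-sum (index ρ) (λ q j → weight W j q) q′)) ≈ᴹ-refl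
                              (graph-push (column W) ρ q′)
    ; balance      = ≈ᴹ-trans (+ᴹ-congˡ (PushM.sum-push (index ρ) (image W))) (balance W)
    }

  witness-++ : Witness y₁ lab₁ co₁ cols₁ → Witness y₂ lab₂ co₂ cols₂ →
               Witness (y₁ +ᴹ y₂) (lab₁ ++ lab₂) (co₁ ++ co₂) (cols₁ ++ cols₂)
  witness-++ {cols₁ = cols₁} {cols₂ = cols₂} W₁ W₂ =
    witness-append (witness-regroup W₁ (inl⇒ {B = cols₂})) (witness-regroup W₂ (inr⇒ {A = cols₁}))

  witness-* : ∀ s → Witness y lab co cols → Witness (s *ₗ y) lab (map (s *_) co) cols
  witness-* {y = y} s W = record
    { weight       = λ j q → s * weight W j q
    ; weight-label = λ j q → Sum.map₁ (λ w≈0 → trans (*-congˡ w≈0) (zeroʳ s)) (weight-label W j q)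
    ; row-sum      = λ j → trans (*-congˡ (row-sum W j)) (*-distribˡ-sum s (weight W j))
    ; image        = λ q → s *ₗ image W q
    ; column       = λ q → graph-resp (*-distribˡ-sum s (λ j → weight W j q)) ≈ᴹ-refl (graph-* s (column W q))
    ; balance      = begin
        s *ₗ y +ᴹ sumᴹ (λ q → s *ₗ image W q)  ≈⟨ +ᴹ-congˡ (sum-homo +ᴹ-monoid +ᴹ-monoid (*ₗ-distribˡ s) (*ₗ-zeroʳ s) (image W)) ⟨
        s *ₗ y +ᴹ s *ₗ sumᴹ (image W)          ≈⟨ *ₗ-distribˡ s y (sumᴹ (image W)) ⟨
        s *ₗ (y +ᴹ sumᴹ (image W))             ≈⟨ *ₗ-congˡ (balance W) ⟩
        s *ₗ 0ᴹ                                ≈⟨ *ₗ-zeroʳ s ⟩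
        0ᴹ                                     ∎
    }
    where open import Relation.Binary.Reasoning.Setoid ≈ᴹ-setoid

  -1*ₗ≈-ᴹ : ∀ x → (- 1#) *ₗ x ≈ᴹ -ᴹ x
  -1*ₗ≈-ᴹ x = +ᴹG.inverseˡ-unique ((- 1#) *ₗ x) x (begin
    (- 1#) *ₗ x +ᴹ x            ≈⟨ +ᴹ-congˡ (*ₗ-identityˡ x) ⟨
    (- 1#) *ₗ x +ᴹ 1# *ₗ x      ≈⟨ *ₗ-distribʳ x (- 1#) 1# ⟨
    (- 1# + 1#) *ₗ x            ≈⟨ *ₗ-congʳ (-‿inverseˡ 1#) ⟩
    0# *ₗ x                     ≈⟨ *ₗ-zeroˡ x ⟩
    0ᴹ                          ∎)
    where open import Relation.Binary.Reasoning.Setoid ≈ᴹ-setoid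

  witness-neg : Witness y lab co cols → Witness (-ᴹ y) lab (map -_ co) cols
  witness-neg {y = y} W = witness-resp (-1*ₗ≈-ᴹ y) (λ _ → ≡.refl) (λ j → -1*x≈-x _) (witness-* (- 1#) W)
    where open import Algebra.Properties.Ring ring using (-1*x≈-x)

  witness-push : Witness y lab co cols → (β : lab ⇒ lab′) → (∀ p → push (index β) co p ≈ co′ p) →
                 Witness y lab′ co′ cols
  witness-push {lab′ = lab′} W β pushed = record
    { weight       = λ p q → push (index β) (λ j → weight W j q) p
    ; weight-label = λ p q → PushR.push-⊎ (index β) p (λ j e →
                       Sum.map₂ (λ l → ≡.trans (≡.cong lab′ (≡.sym e)) (≡.trans (≡.sym (preserves β j)) l))
                                (weight-label W j q))
    ; row-sum      = λ p → trans (sym (pushed p))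
                       (trans (PushR.push-cong (index β) (row-sum W) p) (sym (PushR.push-sum (index β) (weight W) p)))
    ; image        = image W
    ; column       = λ q → graph-resp (sym (PushR.sum-push (index β) (λ j → weight W j q))) ≈ᴹ-refl (column W q)
    ; balance      = balance W
    }

  -- The proofs in weight-label decide which columns carry the system of entry zero.
  witness-gather : ∀ {y m n} {lab : Vector System (suc m)} {co} {cols : Vector System n} →
                   Witness y lab co cols →
                   Σ[ W ∈ Witness y lab co (lab zero ∷ cols) ] (∀ q → weight W zero (suc q) ≈ 0#)
  witness-gather {n = n} {lab = lab} {cols = cols} W = witness-regroup W ρ , outside
    where
    gatherInto : ∀ q → weight W zero q ≈ 0# ⊎ lab zero ≡ cols q → Fin (suc n)
    gatherInto q (inj₁ _) = suc q
    gatherInto q (inj₂ _) = zero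
    target : Fin n → Fin (suc n)
    target q = gatherInto q (weight-label W zero q)
    preserved : ∀ q → cols q ≡ (lab zero ∷ cols) (target q)
    preserved q with weight-label W zero q
    ... | inj₁ _      = ≡.refl
    ... | inj₂ lab≡cols = ≡.sym lab≡cols
    ρ : cols ⇒ lab zero ∷ cols
    ρ = record { index = target ; preserves = preserved }
    outside : ∀ q′ → push target (weight W zero) (suc q′) ≈ 0#
    outside q′ = sum-zero +-monoid {n} off
      where
      off : ∀ q → PushR.place (target q) (weight W zero q) (suc q′) ≈ 0#
      off q with weight-label W zero q
      ... | inj₁ w≈0 = trans (PushR.place-cong (suc q) (suc q′) w≈0) (PushR.place-0 (suc q) (suc q′))
      ... | inj₂ _   = refl

  gathered-weight : ∀ {y m n σ} {lab : Vector System (suc m)} {co} {cols : Vector System n} →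
                 (W : Witness y lab co (σ ∷ cols)) → (∀ q → weight W zero (suc q) ≈ 0#) →
                 co zero ≈ weight W zero zero
  gathered-weight {n = n} W outside =
    trans (row-sum W zero) (trans (+-congˡ (sum-zero +-monoid {n} outside)) (+-identityʳ _))

  witness-tail : ∀ {y m n} {lab : Vector System (suc m)} {co} {cols : Vector System n} →
                 (W : Witness y lab co cols) → (∀ q → weight W zero q ≈ 0#) → Witness y (tail lab) (tail co) cols
  witness-tail W zeroRow = record
    { weight       = weight W ∘ suc
    ; weight-label = weight-label W ∘ suc
    ; row-sum      = row-sum W ∘ suc
    ; image        = image W
    ; column       = λ q → graph-resp (trans (+-congʳ (zeroRow q)) (+-identityˡ _)) ≈ᴹ-refl (column W q)
    ; balance      = balance W
    }

  witness-drop : ∀ {y m n} {lab : Vector System (suc m)} {co} {cols : Vector System n} →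
                 co zero ≈ 0# → Witness y lab co cols → Witness y (tail lab) (tail co) (lab zero ∷ cols)
  witness-drop co₀≈0 W with witness-gather W
  ... | W′ , outside = witness-tail W′ zeroRow
    where
    zeroRow : ∀ q → weight W′ zero q ≈ 0#
    zeroRow zero    = trans (sym (gathered-weight W′ outside)) co₀≈0
    zeroRow (suc q) = outside q

  vanishes-dropPrefix : ∀ {m₁} {lab₁ : Vector System m₁} {co₁ : Vector Carrier m₁} →
                        (∀ i → co₁ i ≈ 0#) → Witness y (lab₁ ++ lab₂) (co₁ ++ co₂) cols →
                        Vanishes y lab₂ co₂
  vanishes-dropPrefix {m₁ = zero}  _     W = vanishes W
  vanishes-dropPrefix {lab₂ = lab₂} {co₂ = co₂} {m₁ = suc m₁} {lab₁} {co₁} zeros W =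
    vanishes-dropPrefix (zeros ∘ suc)
      (witness-resp ≈ᴹ-refl (tail-++ lab₁ lab₂) (λ j → reflexive (tail-++ co₁ co₂ j))
                    (witness-drop (zeros zero) W))

  -- Equality in the free module on systems: equal pushforwards onto common columns.
  record FormallyEqual {m m′} (lab : Vector System m) (co : Vector Carrier m)
                       (lab′ : Vector System m′) (co′ : Vector Carrier m′) : Set L where
    field
      {width}   : ℕ
      {columns} : Vector System width
      left      : lab ⇒ columns
      right     : lab′ ⇒ columns
      agree     : ∀ q → push (index left) co q ≈ push (index right) co′ q
  open FormallyEqual

  push-neg : ∀ {m n} (β : Fin m → Fin n) c q → push β (map -_ c) q ≈ - push β c q
  push-neg β = PushR.push-homo β (λ x y → sym (+R.⁻¹-∙-comm x y)) +R.ε⁻¹≈ε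

  push-[,] : ∀ {m m′ n} {A : Vector System m} {B : Vector System m′} {cols : Vector System n}
             (α : A ⇒ cols) (β : B ⇒ cols) a b q →
             push (index [ α , β ]⇒) (a ++ b) q ≈ push (index α) a q + push (index β) b q
  push-[,] α β = PushR.push-++ (index α) (index β)

  push-[,]-diff : ∀ {m m′ n} {A : Vector System m} {B : Vector System m′} {cols : Vector System n}
                  (α : A ⇒ cols) (β : B ⇒ cols) a b q →
                  push (index [ α , β ]⇒) (a ++ map -_ b) q ≈ push (index α) a q - push (index β) b q
  push-[,]-diff α β a b q = trans (push-[,] α β a (map -_ b) q) (+-congˡ (push-neg (index β) b q))

  -- Append a formally vanishing witness for lab′ − lab, merge the two copies of lab and drop them.
  transport : ∀ {y m m′ n} {lab : Vector System m} {co} {lab′ : Vector System m′} {co′}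
              {cols : Vector System n} →
              FormallyEqual lab co lab′ co′ → Witness y lab co cols → Vanishes y lab′ co′
  transport {m = m} {m′} {lab = lab} {co} {lab′} {co′} e W =
    vanishes-dropPrefix {co₁ = zeros} (λ _ → refl)
      (witness-push (witness-resp (+ᴹ-identityʳ _) (λ _ → ≡.refl) (λ _ → refl) (witness-++ W cancelling))
                    P pushed)
    where
    open import Relation.Binary.Reasoning.Setoid setoid
    zeros : Vector Carrier m
    zeros _ = 0#
    cancelling : Witness 0ᴹ (lab′ ++ lab) (co′ ++ map -_ co) (columns e)
    cancelling = witness-formal ≈ᴹ-refl [ right e , left e ]⇒ λ q →
      trans (push-[,]-diff (right e) (left e) co′ co q) (trans (+-congˡ (-‿cong (agree e q))) (-‿inverseʳ _))
    inLab : lab ⇒ lab ++ lab′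
    inLab = inl⇒
    inLab′ : lab′ ⇒ lab ++ lab′
    inLab′ = inr⇒
    P : lab ++ (lab′ ++ lab) ⇒ lab ++ lab′
    P = [ inLab , [ inLab′ , inLab ]⇒ ]⇒
    collapse : ∀ p → push (index P) (co ++ (co′ ++ map -_ co)) p ≈ push (m ↑ʳ_) co′ p
    collapse p = begin
      push (index P) (co ++ (co′ ++ map -_ co)) p
        ≈⟨ push-[,] inLab [ inLab′ , inLab ]⇒ co (co′ ++ map -_ co) p ⟩
      push (index inLab) co p + push (index [ inLab′ , inLab ]⇒) (co′ ++ map -_ co) p
        ≈⟨ +-congˡ (push-[,]-diff inLab′ inLab co′ co p) ⟩
      push (index inLab) co p + (push (index inLab′) co′ p - push (index inLab) co p)
        ≈⟨ +-assoc _ _ _ ⟨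
      push (index inLab) co p + push (index inLab′) co′ p - push (index inLab) co p
        ≈⟨ +R.xyx⁻¹≈y _ _ ⟩
      push (m ↑ʳ_) co′ p ∎
    pushed : ∀ p → push (index P) (co ++ (co′ ++ map -_ co)) p ≈ (zeros ++ co′) p
    pushed p = trans (collapse p) (↑-elim (λ p → push (m ↑ʳ_) co′ p ≈ (zeros ++ co′) p) miss hit p)
      where
      miss : ∀ i → push (m ↑ʳ_) co′ (i ↑ˡ m′) ≈ (zeros ++ co′) (i ↑ˡ m′)
      miss i = trans (PushR.push-miss (m ↑ʳ_) co′ (i ↑ˡ m′) (λ j e → ↑ˡ≢↑ʳ i j (≡.sym e)))
                     (reflexive (≡.sym (lookup-++ˡ zeros co′ i)))
      hit : ∀ j → push (m ↑ʳ_) co′ (m ↑ʳ j) ≈ (zeros ++ co′) (m ↑ʳ j)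
      hit j = trans (PushR.push-hit (m ↑ʳ_) (↑ʳ-injective m _ _) co′ j)
                    (reflexive (≡.sym (lookup-++ʳ zeros co′ j)))

  vanishes-resp : ∀ {y y′ m} {lab : Vector System m} {co} → y ≈ᴹ y′ → Vanishes y lab co → Vanishes y′ lab co
  vanishes-resp y≈y′ (vanishes W) = vanishes (witness-resp y≈y′ (λ _ → ≡.refl) (λ _ → refl) W)

  -- base + Σⱼ coefficientsⱼ·x_{generatorsⱼ}, where x_σ is the adjoined solution of σ.
  record Element : Set L where
    constructor element
    field
      base         : Carrierᴹ
      {terms}      : ℕ
      generators   : Vector System terms
      coefficients : Vector Carrier terms
  open Element

  infixl 6 _⊞_
  infixr 7 _⊛_
  infix  4 _≋_

  _⊞_ : Element → Element → Element
  X ⊞ Y = element (base X +ᴹ base Y) (generators X ++ generators Y) (coefficients X ++ coefficients Y)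

  ⊟_ : Element → Element
  ⊟ X = element (-ᴹ base X) (generators X) (map -_ (coefficients X))

  _⊛_ : Carrier → Element → Element
  s ⊛ X = element (s *ₗ base X) (generators X) (map (s *_) (coefficients X))

  𝟘 : Element
  𝟘 = element 0ᴹ [] []

  record _≋_ (X Y : Element) : Set L where
    constructor ≋-vanishes
    field
      difference : Vanishes (base (X ⊞ ⊟ Y)) (generators (X ⊞ ⊟ Y)) (coefficients (X ⊞ ⊟ Y))

  ≋-formal : ∀ {X Y} → base X ≈ᴹ base Y →
             FormallyEqual (generators X) (coefficients X) (generators Y) (coefficients Y) → X ≋ Y
  ≋-formal {X} {Y} x≈y e =
    ≋-vanishes (vanishes (witness-formal (+ᴹG.x≈y⇒x∙y⁻¹≈ε x≈y) [ left e , right e ]⇒ λ q →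
      trans (push-[,]-diff (left e) (right e) (coefficients X) (coefficients Y) q)
            (trans (+-congʳ (agree e q)) (-‿inverseʳ _))))

  formal-pointwise : ∀ {m} {lab : Vector System m} {co co′} →
                     (∀ j → co j ≈ co′ j) → FormallyEqual lab co lab co′
  formal-pointwise {m} co≈co′ = record { left = id⇒ ; right = id⇒ ; agree = PushR.push-cong {m} id co≈co′ }

  ⊞-comm : ∀ X Y → X ⊞ Y ≋ Y ⊞ X
  ⊞-comm X Y = ≋-formal (+ᴹ-comm _ _) record
    { left  = [ inX , inY ]⇒
    ; right = [ inY , inX ]⇒
    ; agree = λ q → begin
        push (index [ inX , inY ]⇒) (coefficients X ++ coefficients Y) q
          ≈⟨ push-[,] inX inY (coefficients X) (coefficients Y) q ⟩
        push (index inX) (coefficients X) q + push (index inY) (coefficients Y) q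
          ≈⟨ +-comm _ _ ⟩
        push (index inY) (coefficients Y) q + push (index inX) (coefficients X) q
          ≈⟨ push-[,] inY inX (coefficients Y) (coefficients X) q ⟨
        push (index [ inY , inX ]⇒) (coefficients Y ++ coefficients X) q ∎
    }
    where
    open import Relation.Binary.Reasoning.Setoid setoid
    inX : generators X ⇒ generators X ++ generators Y
    inX = inl⇒
    inY : generators Y ⇒ generators X ++ generators Y
    inY = inr⇒

  ⊞-assoc : ∀ X Y Z → (X ⊞ Y) ⊞ Z ≋ X ⊞ (Y ⊞ Z)
  ⊞-assoc X Y Z = ≋-formal (+ᴹ-assoc _ _ _) record
    { left  = [ [ inX , inY ]⇒ , inZ ]⇒
    ; right = [ inX , [ inY , inZ ]⇒ ]⇒
    ; agree = λ q → begin
        push (index [ [ inX , inY ]⇒ , inZ ]⇒) ((cX ++ cY) ++ cZ) q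
          ≈⟨ push-[,] [ inX , inY ]⇒ inZ (cX ++ cY) cZ q ⟩
        push (index [ inX , inY ]⇒) (cX ++ cY) q + push (index inZ) cZ q
          ≈⟨ +-congʳ (push-[,] inX inY cX cY q) ⟩
        push (index inX) cX q + push (index inY) cY q + push (index inZ) cZ q
          ≈⟨ +-assoc _ _ _ ⟩
        push (index inX) cX q + (push (index inY) cY q + push (index inZ) cZ q)
          ≈⟨ +-congˡ (push-[,] inY inZ cY cZ q) ⟨
        push (index inX) cX q + push (index [ inY , inZ ]⇒) (cY ++ cZ) q
          ≈⟨ push-[,] inX [ inY , inZ ]⇒ cX (cY ++ cZ) q ⟨
        push (index [ inX , [ inY , inZ ]⇒ ]⇒) (cX ++ (cY ++ cZ)) q ∎
    }
    where
    open import Relation.Binary.Reasoning.Setoid setoid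
    cX : Vector Carrier (terms X)
    cX = coefficients X
    cY : Vector Carrier (terms Y)
    cY = coefficients Y
    cZ : Vector Carrier (terms Z)
    cZ = coefficients Z
    inX : generators X ⇒ generators (X ⊞ (Y ⊞ Z))
    inX = inl⇒
    inY : generators Y ⇒ generators (X ⊞ (Y ⊞ Z))
    inY = inr⇒ {A = generators X} ∘⇒ inl⇒ {B = generators Z}
    inZ : generators Z ⇒ generators (X ⊞ (Y ⊞ Z))
    inZ = inr⇒ {A = generators X} ∘⇒ inr⇒ {A = generators Y}

  ⊞-identityˡ : ∀ X → 𝟘 ⊞ X ≋ X
  ⊞-identityˡ X = ≋-formal (+ᴹ-identityˡ _) (formal-pointwise (λ _ → refl))

  module _ (X : Element) where
    private
      idX : generators X ⇒ generators X
      idX = id⇒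

    ⊞-identityʳ : X ⊞ 𝟘 ≋ X
    ⊞-identityʳ = ≋-formal (+ᴹ-identityʳ _) record
      { left  = [ idX , []⇒ ]⇒
      ; right = idX
      ; agree = λ q → trans (push-[,] idX []⇒ (coefficients X) [] q) (+-identityʳ _)
      }

    ⊟-inverseˡ : ⊟ X ⊞ X ≋ 𝟘
    ⊟-inverseˡ = ≋-formal (-ᴹ‿inverseˡ _) record
      { left  = [ idX , idX ]⇒
      ; right = []⇒
      ; agree = λ q → trans (push-[,] idX idX (map -_ (coefficients X)) (coefficients X) q)
                            (trans (+-congʳ (push-neg id (coefficients X) q)) (-‿inverseˡ _))
      }

    ⊟-inverseʳ : X ⊞ ⊟ X ≋ 𝟘
    ⊟-inverseʳ = ≋-formal (-ᴹ‿inverseʳ _) record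
      { left  = [ idX , idX ]⇒
      ; right = []⇒
      ; agree = λ q → trans (push-[,] idX idX (coefficients X) (map -_ (coefficients X)) q)
                            (trans (+-congˡ (push-neg id (coefficients X) q)) (-‿inverseʳ _))
      }

    ⊛-distribʳ : ∀ s t → (s + t) ⊛ X ≋ s ⊛ X ⊞ t ⊛ X
    ⊛-distribʳ s t = ≋-formal (*ₗ-distribʳ _ s t) record
      { left  = idX
      ; right = [ idX , idX ]⇒
      ; agree = λ q → trans (PushR.push-cong id (λ j → distribʳ _ s t) q)
                      (trans (PushR.push-+ id (map (s *_) (coefficients X)) (map (t *_) (coefficients X)) q)
                             (sym (push-[,] idX idX (map (s *_) (coefficients X)) (map (t *_) (coefficients X)) q)))
      }

  ⊛-identityˡ : ∀ X → 1# ⊛ X ≋ X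
  ⊛-identityˡ X = ≋-formal (*ₗ-identityˡ _) (formal-pointwise (λ j → *-identityˡ _))

  ⊛-assoc : ∀ s t X → (s * t) ⊛ X ≋ s ⊛ t ⊛ X
  ⊛-assoc s t X = ≋-formal (*ₗ-assoc s t _) (formal-pointwise (λ j → *-assoc s t _))

  ⊛-zeroˡ : ∀ X → 0# ⊛ X ≋ 𝟘
  ⊛-zeroˡ X = ≋-formal (*ₗ-zeroˡ _) record
    { left  = id⇒
    ; right = []⇒
    ; agree = λ q → trans (PushR.push-cong id (λ j → zeroˡ _) q) (PushR.push-id (λ _ → 0#) q)
    }

  ⊛-zeroʳ : ∀ s → s ⊛ 𝟘 ≋ 𝟘
  ⊛-zeroʳ s = ≋-formal (*ₗ-zeroʳ s) (formal-pointwise (λ ()))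

  ⊛-distribˡ : ∀ s X Y → s ⊛ (X ⊞ Y) ≋ s ⊛ X ⊞ s ⊛ Y
  ⊛-distribˡ s X Y = ≋-formal (*ₗ-distribˡ s _ _)
    (formal-pointwise (λ j → reflexive (map-++ (s *_) (coefficients X) (coefficients Y) j)))


  ≋-refl : ∀ {X} → X ≋ X
  ≋-refl = ≋-formal ≈ᴹ-refl (formal-pointwise (λ _ → refl))

  ≋-sym : ∀ {X Y} → X ≋ Y → Y ≋ X
  ≋-sym {X} {Y} (≋-vanishes (vanishes W)) =
    ≋-vanishes (vanishes-resp (+ᴹG.⁻¹-anti-homo‿- (base X) (base Y)) (transport swapped (witness-neg W)))
    where
    open import Relation.Binary.Reasoning.Setoid setoid
    cX : Vector Carrier (terms X)
    cX = coefficients X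
    cY : Vector Carrier (terms Y)
    cY = coefficients Y
    inX : generators X ⇒ generators X ++ generators Y
    inX = inl⇒
    inY : generators Y ⇒ generators X ++ generators Y
    inY = inr⇒
    swapped : FormallyEqual (generators X ++ generators Y) (map -_ (cX ++ map -_ cY))
                            (generators Y ++ generators X) (cY ++ map -_ cX)
    swapped = record
      { left  = [ inX , inY ]⇒
      ; right = [ inY , inX ]⇒
      ; agree = λ q → begin
          push (index [ inX , inY ]⇒) (map -_ (cX ++ map -_ cY)) q
            ≈⟨ push-neg (index [ inX , inY ]⇒) (cX ++ map -_ cY) q ⟩
          - push (index [ inX , inY ]⇒) (cX ++ map -_ cY) q
            ≈⟨ -‿cong (push-[,]-diff inX inY cX cY q) ⟩
          - (push (index inX) cX q - push (index inY) cY q)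
            ≈⟨ +R.⁻¹-anti-homo‿- _ _ ⟩
          push (index inY) cY q - push (index inX) cX q
            ≈⟨ push-[,]-diff inY inX cY cX q ⟨
          push (index [ inY , inX ]⇒) (cY ++ map -_ cX) q ∎
      }

  ≋-trans : ∀ {X Y Z} → X ≋ Y → Y ≋ Z → X ≋ Z
  ≋-trans {X} {Y} {Z} (≋-vanishes (vanishes W₁)) (≋-vanishes (vanishes W₂)) =
    ≋-vanishes (vanishes-resp ([x-y]∙[y-z]≈x-z +ᴹ-abelianGroup (base X) (base Y) (base Z))
                              (transport telescoped (witness-++ W₁ W₂)))
    where
    open import Relation.Binary.Reasoning.Setoid setoid
    cX : Vector Carrier (terms X)
    cX = coefficients X
    cY : Vector Carrier (terms Y)
    cY = coefficients Y
    cZ : Vector Carrier (terms Z)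
    cZ = coefficients Z
    inX : generators X ⇒ generators (X ⊞ (Y ⊞ Z))
    inX = inl⇒
    inY : generators Y ⇒ generators (X ⊞ (Y ⊞ Z))
    inY = inr⇒ {A = generators X} ∘⇒ inl⇒ {B = generators Z}
    inZ : generators Z ⇒ generators (X ⊞ (Y ⊞ Z))
    inZ = inr⇒ {A = generators X} ∘⇒ inr⇒ {A = generators Y}
    pX pY pZ : Fin (terms (X ⊞ (Y ⊞ Z))) → Carrier
    pX = push (index inX) cX
    pY = push (index inY) cY
    pZ = push (index inZ) cZ
    telescoped : FormallyEqual ((generators X ++ generators Y) ++ (generators Y ++ generators Z))
                               ((cX ++ map -_ cY) ++ (cY ++ map -_ cZ))
                               (generators X ++ generators Z) (cX ++ map -_ cZ)
    telescoped = record
      { left  = [ [ inX , inY ]⇒ , [ inY , inZ ]⇒ ]⇒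
      ; right = [ inX , inZ ]⇒
      ; agree = λ q → begin
          push (index [ [ inX , inY ]⇒ , [ inY , inZ ]⇒ ]⇒) ((cX ++ map -_ cY) ++ (cY ++ map -_ cZ)) q
            ≈⟨ push-[,] [ inX , inY ]⇒ [ inY , inZ ]⇒ (cX ++ map -_ cY) (cY ++ map -_ cZ) q ⟩
          push (index [ inX , inY ]⇒) (cX ++ map -_ cY) q + push (index [ inY , inZ ]⇒) (cY ++ map -_ cZ) q
            ≈⟨ +-cong (push-[,]-diff inX inY cX cY q) (push-[,]-diff inY inZ cY cZ q) ⟩
          (pX q - pY q) + (pY q - pZ q)
            ≈⟨ [x-y]∙[y-z]≈x-z +-abelianGroup (pX q) (pY q) (pZ q) ⟩
          pX q - pZ q
            ≈⟨ push-[,]-diff inX inZ cX cZ q ⟨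
          push (index [ inX , inZ ]⇒) (cX ++ map -_ cZ) q ∎
      }

  ⊞-cong : ∀ {X X′ Y Y′} → X ≋ X′ → Y ≋ Y′ → X ⊞ Y ≋ X′ ⊞ Y′
  ⊞-cong {X} {X′} {Y} {Y′} (≋-vanishes (vanishes W₁)) (≋-vanishes (vanishes W₂)) =
    ≋-vanishes (vanishes-resp ([x-y]∙[u-v]≈[x∙u]-[y∙v] +ᴹ-abelianGroup (base X) (base X′) (base Y) (base Y′))
                              (transport regrouped (witness-++ W₁ W₂)))
    where
    open import Relation.Binary.Reasoning.Setoid setoid
    Both : Vector System (terms ((X ⊞ Y) ⊞ (X′ ⊞ Y′)))
    Both = generators ((X ⊞ Y) ⊞ (X′ ⊞ Y′))
    inX : generators X ⇒ Both
    inX = inl⇒ ∘⇒ inl⇒ {B = generators Y}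
    inY : generators Y ⇒ Both
    inY = inl⇒ ∘⇒ inr⇒ {A = generators X}
    inX′ : generators X′ ⇒ Both
    inX′ = inr⇒ {A = generators X ++ generators Y} ∘⇒ inl⇒ {B = generators Y′}
    inY′ : generators Y′ ⇒ Both
    inY′ = inr⇒ {A = generators X ++ generators Y} ∘⇒ inr⇒ {A = generators X′}
    cX : Vector Carrier (terms X)
    cX = coefficients X
    cY : Vector Carrier (terms Y)
    cY = coefficients Y
    cX′ : Vector Carrier (terms X′)
    cX′ = coefficients X′
    cY′ : Vector Carrier (terms Y′)
    cY′ = coefficients Y′
    pX pY pX′ pY′ : Fin (terms ((X ⊞ Y) ⊞ (X′ ⊞ Y′))) → Carrier
    pX  = push (index inX) cX
    pY  = push (index inY) cY
    pX′ = push (index inX′) cX′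
    pY′ = push (index inY′) cY′
    regrouped : FormallyEqual ((generators X ++ generators X′) ++ (generators Y ++ generators Y′))
                              ((cX ++ map -_ cX′) ++ (cY ++ map -_ cY′))
                              (generators (X ⊞ Y) ++ generators (X′ ⊞ Y′)) ((cX ++ cY) ++ map -_ (cX′ ++ cY′))
    regrouped = record
      { left  = [ [ inX , inX′ ]⇒ , [ inY , inY′ ]⇒ ]⇒
      ; right = [ [ inX , inY ]⇒ , [ inX′ , inY′ ]⇒ ]⇒
      ; agree = λ q → begin
          push (index [ [ inX , inX′ ]⇒ , [ inY , inY′ ]⇒ ]⇒) ((cX ++ map -_ cX′) ++ (cY ++ map -_ cY′)) q
            ≈⟨ push-[,] [ inX , inX′ ]⇒ [ inY , inY′ ]⇒ (cX ++ map -_ cX′) (cY ++ map -_ cY′) q ⟩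
          push (index [ inX , inX′ ]⇒) (cX ++ map -_ cX′) q + push (index [ inY , inY′ ]⇒) (cY ++ map -_ cY′) q
            ≈⟨ +-cong (push-[,]-diff inX inX′ cX cX′ q) (push-[,]-diff inY inY′ cY cY′ q) ⟩
          (pX q - pX′ q) + (pY q - pY′ q)
            ≈⟨ [x-y]∙[u-v]≈[x∙u]-[y∙v] +-abelianGroup (pX q) (pX′ q) (pY q) (pY′ q) ⟩
          (pX q + pY q) - (pX′ q + pY′ q)
            ≈⟨ +-cong (push-[,] inX inY cX cY q) (-‿cong (push-[,] inX′ inY′ cX′ cY′ q)) ⟨
          push (index [ inX , inY ]⇒) (cX ++ cY) q - push (index [ inX′ , inY′ ]⇒) (cX′ ++ cY′) q
            ≈⟨ push-[,]-diff [ inX , inY ]⇒ [ inX′ , inY′ ]⇒ (cX ++ cY) (cX′ ++ cY′) q ⟨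
          push (index [ [ inX , inY ]⇒ , [ inX′ , inY′ ]⇒ ]⇒) ((cX ++ cY) ++ map -_ (cX′ ++ cY′)) q ∎
      }

  ⊟-cong : ∀ {X Y} → X ≋ Y → ⊟ X ≋ ⊟ Y
  ⊟-cong {X} {Y} (≋-vanishes (vanishes W)) = ≋-vanishes (vanishes
    (witness-resp (≈ᴹ-sym (+ᴹG.⁻¹-∙-comm (base X) (-ᴹ base Y))) (λ _ → ≡.refl)
                  (λ j → reflexive (map-++ -_ (coefficients X) (map -_ (coefficients Y)) j))
                  (witness-neg W)))

  *ₗ-negʳ : ∀ s x → s *ₗ (-ᴹ x) ≈ᴹ -ᴹ (s *ₗ x)
  *ₗ-negʳ s x = +ᴹG.inverseˡ-unique (s *ₗ (-ᴹ x)) (s *ₗ x)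
    (≈ᴹ-trans (≈ᴹ-sym (*ₗ-distribˡ s (-ᴹ x) x)) (≈ᴹ-trans (*ₗ-congˡ (-ᴹ‿inverseˡ x)) (*ₗ-zeroʳ s)))

  ⊛-congˡ : ∀ {s X Y} → X ≋ Y → s ⊛ X ≋ s ⊛ Y
  ⊛-congˡ {s} {X} {Y} (≋-vanishes (vanishes W)) = ≋-vanishes (vanishes
    (witness-resp (≈ᴹ-trans (*ₗ-distribˡ s _ _) (+ᴹ-congˡ (*ₗ-negʳ s (base Y)))) (λ _ → ≡.refl) scaled
                  (witness-* s W)))
    where
    open import Algebra.Properties.Ring ring using (-‿distribʳ-*)
    scaled : ∀ j → map (s *_) (coefficients X ++ map -_ (coefficients Y)) j
                   ≈ (map (s *_) (coefficients X) ++ map -_ (map (s *_) (coefficients Y))) j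
    scaled j = trans (reflexive (map-++ (s *_) (coefficients X) (map -_ (coefficients Y)) j))
                     (++⁺ _≈_ (λ _ → refl) (λ i → sym (-‿distribʳ-* s (coefficients Y i))) j)

  ⊛-congʳ : ∀ {s t} X → s ≈ t → s ⊛ X ≋ t ⊛ X
  ⊛-congʳ X s≈t = ≋-formal (*ₗ-congʳ s≈t) (formal-pointwise (λ _ → *-congʳ s≈t))

  ⊛-cong : ∀ {s t X Y} → s ≈ t → X ≋ Y → s ⊛ X ≋ t ⊛ Y
  ⊛-cong {Y = Y} s≈t X≋Y = ≋-trans (⊛-congˡ X≋Y) (⊛-congʳ Y s≈t)

  M⁺ : Module R L L
  M⁺ = record
    { Carrierᴹ = Element
    ; _≈ᴹ_     = _≋_
    ; _+ᴹ_     = _⊞_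
    ; _*ₗ_     = _⊛_
    ; _*ᵣ_     = flip _⊛_
    ; 0ᴹ       = 𝟘
    ; -ᴹ_      = ⊟_
    ; isModule = IsModuleFromLeft.isModule {commutativeRing = R} record
      { isLeftModule = record
        { isLeftSemimodule = record
          { +ᴹ-isCommutativeMonoid = record
            { isMonoid = record
              { isSemigroup = record
                { isMagma = record
                  { isEquivalence = record { refl = ≋-refl ; sym = ≋-sym ; trans = ≋-trans }
                  ; ∙-cong        = ⊞-cong
                  }
                ; assoc = ⊞-assoc
                }
              ; identity = ⊞-identityˡ , ⊞-identityʳ
              }
            ; comm = ⊞-comm
            }
          ; isPreleftSemimodule = record
            { *ₗ-cong      = ⊛-cong
            ; *ₗ-zeroˡ     = ⊛-zeroˡ
            ; *ₗ-distribʳ  = ⊛-distribʳ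
            ; *ₗ-identityˡ = ⊛-identityˡ
            ; *ₗ-assoc     = ⊛-assoc
            ; *ₗ-zeroʳ     = ⊛-zeroʳ
            ; *ₗ-distribˡ  = ⊛-distribˡ
            }
          }
        ; -ᴹ‿cong    = ⊟-cong
        ; -ᴹ‿inverse = ⊟-inverseˡ , ⊟-inverseʳ
        }
      }
    }

  embed : Carrierᴹ → Element
  embed x = element x [] []

  -- Without generators every column sum is 0, and compatibility forces the images to vanish.
  base-vanishes : ∀ {y n} {lab : Vector System zero} {co} {cols : Vector System n} →
                  Witness y lab co cols → y ≈ᴹ 0ᴹ
  base-vanishes {y} W = begin
    y                    ≈⟨ +ᴹ-identityʳ y ⟨
    y +ᴹ 0ᴹ              ≈⟨ +ᴹ-congˡ (sum-zero +ᴹ-monoid (λ q → graph-from-0 (column W q))) ⟨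
    y +ᴹ sumᴹ (image W)  ≈⟨ balance W ⟩
    0ᴹ                   ∎
    where open import Relation.Binary.Reasoning.Setoid ≈ᴹ-setoid

  embed-isModuleMonomorphism : IsModuleMonomorphism (Module.rawModule M) (Module.rawModule M⁺) embed
  embed-isModuleMonomorphism = record
    { isModuleHomomorphism = record
      { isBimoduleHomomorphism = record
        { +ᴹ-isGroupHomomorphism = record
          { isMonoidHomomorphism = record
            { isMagmaHomomorphism = record
              { isRelHomomorphism = record { cong = λ x≈y → ≋-formal x≈y (formal-pointwise (λ ())) }
              ; homo              = λ x y → ≋-formal ≈ᴹ-refl (formal-pointwise (λ ()))
              }
            ; ε-homo = ≋-formal ≈ᴹ-refl (formal-pointwise (λ ()))
            }
          ; ⁻¹-homo = λ x → ≋-formal ≈ᴹ-refl (formal-pointwise (λ ()))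
          }
        ; *ₗ-homo = λ s x → ≋-formal ≈ᴹ-refl (formal-pointwise (λ ()))
        ; *ᵣ-homo = λ s x → ≋-formal (≈ᴹ-sym (*ₗ-*ᵣ-coincident s x)) (formal-pointwise (λ ()))
        }
      }
    ; injective = λ (≋-vanishes (vanishes W)) → +ᴹG.x∙y⁻¹≈ε⇒x≈y _ _ (base-vanishes W)
    }

  solution : System → Element
  solution σ = element 0ᴹ (σ ∷ []) (1# ∷ [])

  witness-relation : ∀ {σ x y} → Graph σ x y → Witness (-ᴹ y) (σ ∷ []) (x ∷ []) (σ ∷ [])
  witness-relation {x = x} {y} g = record
    { weight       = λ _ _ → x
    ; weight-label = λ { zero zero → inj₂ ≡.refl }
    ; row-sum      = λ { zero → sym (+-identityʳ x) }
    ; image        = λ _ → y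
    ; column       = λ { zero → graph-resp (sym (+-identityʳ x)) ≈ᴹ-refl g }
    ; balance      = ≈ᴹ-trans (+ᴹ-congˡ (+ᴹ-identityʳ y)) (-ᴹ‿inverseˡ y)
    }

  solution-solves : ∀ σ i → lhs σ i ⊛ solution σ ≋ embed (rhs σ i)
  solution-solves σ i = ≋-vanishes (vanishes (witness-resp
    (≈ᴹ-trans (≈ᴹ-sym (+ᴹ-identityˡ _)) (+ᴹ-congʳ (≈ᴹ-sym (*ₗ-zeroʳ (lhs σ i)))))
    (λ { zero → ≡.refl })
    (λ { zero → sym (*-identityʳ (lhs σ i)) })
    (witness-relation (graph-target i))))

  -- After gathering, column zero carries σ and sums to the only coefficient g.
  embedded-multiple⇒InIdeal : ∀ σ g w → g ⊛ solution σ ≋ embed w → InIdeal R (lhs σ) g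
  embedded-multiple⇒InIdeal σ g w (≋-vanishes (vanishes W)) with witness-gather W
  ... | W′ , outside = graph-ideal (graph-resp gathered ≈ᴹ-refl (column W′ zero))
    where
    gathered : sum (λ j → weight W′ j zero) ≈ g
    gathered = trans (+-identityʳ _) (trans (sym (gathered-weight W′ outside)) (*-identityʳ g))

-- Unions of chains of monomorphisms

≤′-irrelevant : ∀ {m n} (p q : m ≤′ n) → p ≡ q
≤′-irrelevant (≤′-reflexive m≡n) (≤′-reflexive m≡n′) = ≡.cong ≤′-reflexive (≡-irrelevant m≡n m≡n′)
≤′-irrelevant (≤′-reflexive ≡.refl) (≤′-step q) = contradiction (≤′⇒≤ q) 1+n≰n
≤′-irrelevant (≤′-step p) (≤′-reflexive ≡.refl) = contradiction (≤′⇒≤ p) 1+n≰n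
≤′-irrelevant (≤′-step p) (≤′-step q) = ≡.cong ≤′-step (≤′-irrelevant p q)

m≤′m⊔n : ∀ m n → m ≤′ m ⊔ℕ n
m≤′m⊔n m n = ≤⇒≤′ (m≤m⊔n m n)

n≤′m⊔n : ∀ m n → n ≤′ m ⊔ℕ n
n≤′m⊔n m n = ≤⇒≤′ (m≤n⊔m m n)

module DirectedUnion {r ℓr a ℓ} {R : CommutativeRing r ℓr} (M : ℕ → Module R a ℓ)
  (next : ∀ {s} → Module.Carrierᴹ (M s) → Module.Carrierᴹ (M (suc s)))
  (next-isMonomorphism : ∀ {s} →
     IsModuleMonomorphism (Module.rawModule (M s)) (Module.rawModule (M (suc s))) next)
  where

  open CommutativeRing R using (_≈_; _+_; _*_; 0#; 1#) renaming (Carrier to Scalar)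
  private
    module Stage {s : ℕ} = Module (M s)
  open Stage

  lift : ∀ {s t} → s ≤′ t → Carrierᴹ {s} → Carrierᴹ {t}
  lift ≤′-refl      x = x
  lift (≤′-step s≤t) x = next (lift s≤t x)

  lift-isMonomorphism : ∀ {s t} (s≤t : s ≤′ t) →
                        IsModuleMonomorphism (rawModule {s}) (rawModule {t}) (lift s≤t)
  lift-isMonomorphism ≤′-refl       = Identity.isModuleMonomorphism rawModule ≈ᴹ-refl
  lift-isMonomorphism (≤′-step s≤t) =
    Composition.isModuleMonomorphism ≈ᴹ-trans (lift-isMonomorphism s≤t) next-isMonomorphism

  private
    module Lift {s t} (s≤t : s ≤′ t) = IsModuleMonomorphism (lift-isMonomorphism s≤t)

  lift-trans : ∀ {s t u} (s≤t : s ≤′ t) (t≤u : t ≤′ u) x →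
               lift (≤′-trans s≤t t≤u) x ≡ lift t≤u (lift s≤t x)
  lift-trans s≤t ≤′-refl       x = ≡.refl
  lift-trans s≤t (≤′-step t≤u) x = ≡.cong next (lift-trans s≤t t≤u x)

  lift-irrelevant : ∀ {s t} (p q : s ≤′ t) x → lift p x ≡ lift q x
  lift-irrelevant p q x = ≡.cong (λ s≤t → lift s≤t x) (≤′-irrelevant p q)

  record Union : Set a where
    constructor at
    field
      stage : ℕ
      value : Carrierᴹ {stage}
  open Union

  infixl 8 _↑_
  _↑_ : ∀ {t} (u : Union) → stage u ≤′ t → Carrierᴹ {t}
  u ↑ s≤t = lift s≤t (value u)

  relift : ∀ {s t} (u : Union) (p : stage u ≤′ s) (q : s ≤′ t) (r : stage u ≤′ t) →
           lift q (u ↑ p) ≡ u ↑ r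
  relift u p q r = ≡.trans (≡.sym (lift-trans p q (value u))) (lift-irrelevant (≤′-trans p q) r (value u))

  infix 4 _≈∪_
  record _≈∪_ (u v : Union) : Set ℓ where
    constructor agreeAt
    field
      {bound} : ℕ
      left≤   : stage u ≤′ bound
      right≤  : stage v ≤′ bound
      agree   : u ↑ left≤ ≈ᴹ v ↑ right≤

  -- Lifts are injective, so agreement at one common upper stage gives agreement at any other.
  agree-anywhere : ∀ {u v} → u ≈∪ v → ∀ {t} (p : stage u ≤′ t) (q : stage v ≤′ t) → u ↑ p ≈ᴹ v ↑ q
  agree-anywhere {u} {v} (agreeAt {T} p₀ q₀ u≈v) {t} p q = Lift.injective (n≤′m⊔n T t) (begin
    lift (n≤′m⊔n T t) (u ↑ p)   ≡⟨ relift u p (n≤′m⊔n T t) (≤′-trans p₀ (m≤′m⊔n T t)) ⟩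
    u ↑ ≤′-trans p₀ (m≤′m⊔n T t) ≡⟨ relift u p₀ (m≤′m⊔n T t) (≤′-trans p₀ (m≤′m⊔n T t)) ⟨
    lift (m≤′m⊔n T t) (u ↑ p₀)  ≈⟨ Lift.⟦⟧-cong (m≤′m⊔n T t) u≈v ⟩
    lift (m≤′m⊔n T t) (v ↑ q₀)  ≡⟨ relift v q₀ (m≤′m⊔n T t) (≤′-trans q (n≤′m⊔n T t)) ⟩
    v ↑ ≤′-trans q (n≤′m⊔n T t)  ≡⟨ relift v q (n≤′m⊔n T t) (≤′-trans q (n≤′m⊔n T t)) ⟨
    lift (n≤′m⊔n T t) (v ↑ q)   ∎)
    where open import Relation.Binary.Reasoning.Setoid ≈ᴹ-setoid

  ↑-irrelevant : ∀ {t} u (p q : stage u ≤′ t) → u ↑ p ≡ u ↑ q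
  ↑-irrelevant u p q = lift-irrelevant p q (value u)

  infixl 6 _∪+_
  infixr 7 _∪*_

  _∪+_ : Union → Union → Union
  u ∪+ v = at (stage u ⊔ℕ stage v) (u ↑ m≤′m⊔n (stage u) (stage v) +ᴹ v ↑ n≤′m⊔n (stage u) (stage v))

  ∪-_ : Union → Union
  ∪- u = at (stage u) (-ᴹ value u)

  _∪*_ : Scalar → Union → Union
  s ∪* u = at (stage u) (s *ₗ value u)

  ∪0 : Union
  ∪0 = at 0 0ᴹ

  module _ {t : ℕ} where

    ↑-+ : ∀ u v (p : stage (u ∪+ v) ≤′ t) (pu : stage u ≤′ t) (pv : stage v ≤′ t) →
          (u ∪+ v) ↑ p ≈ᴹ u ↑ pu +ᴹ v ↑ pv
    ↑-+ u v p pu pv = ≈ᴹ-trans (Lift.+ᴹ-homo p _ _)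
      (+ᴹ-cong (≈ᴹ-reflexive (relift u (m≤′m⊔n (stage u) (stage v)) p pu))
               (≈ᴹ-reflexive (relift v (n≤′m⊔n (stage u) (stage v)) p pv)))

    ↑-neg : ∀ u (p : stage u ≤′ t) → (∪- u) ↑ p ≈ᴹ -ᴹ (u ↑ p)
    ↑-neg u p = Lift.-ᴹ-homo p (value u)

    ↑-* : ∀ s u (p : stage u ≤′ t) → (s ∪* u) ↑ p ≈ᴹ s *ₗ (u ↑ p)
    ↑-* s u p = Lift.*ₗ-homo p s (value u)

    ↑-0 : (p : 0 ≤′ t) → ∪0 ↑ p ≈ᴹ 0ᴹ
    ↑-0 p = Lift.0ᴹ-homo p

  ≈∪-refl : ∀ {u} → u ≈∪ u
  ≈∪-refl = agreeAt ≤′-refl ≤′-refl ≈ᴹ-refl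

  ≈∪-sym : ∀ {u v} → u ≈∪ v → v ≈∪ u
  ≈∪-sym (agreeAt p q u≈v) = agreeAt q p (≈ᴹ-sym u≈v)

  ≈∪-trans : ∀ {u v w} → u ≈∪ v → v ≈∪ w → u ≈∪ w
  ≈∪-trans {u} {v} {w} u≈v v≈w = agreeAt pu pw (≈ᴹ-trans (agree-anywhere u≈v pu pv) (agree-anywhere v≈w pv pw))
    where
    uv : ℕ
    uv = stage u ⊔ℕ stage v
    pu : stage u ≤′ uv ⊔ℕ stage w
    pu = ≤′-trans (m≤′m⊔n (stage u) (stage v)) (m≤′m⊔n uv (stage w))
    pv : stage v ≤′ uv ⊔ℕ stage w
    pv = ≤′-trans (n≤′m⊔n (stage u) (stage v)) (m≤′m⊔n uv (stage w))
    pw : stage w ≤′ uv ⊔ℕ stage w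
    pw = n≤′m⊔n uv (stage w)

  ∪+-cong : ∀ {u u′ v v′} → u ≈∪ u′ → v ≈∪ v′ → u ∪+ v ≈∪ u′ ∪+ v′
  ∪+-cong {u} {u′} {v} {v′} u≈u′ v≈v′ = agreeAt p p′ (begin
    (u ∪+ v) ↑ p          ≈⟨ ↑-+ u v p pu pv ⟩
    u ↑ pu +ᴹ v ↑ pv      ≈⟨ +ᴹ-cong (agree-anywhere u≈u′ pu pu′) (agree-anywhere v≈v′ pv pv′) ⟩
    u′ ↑ pu′ +ᴹ v′ ↑ pv′  ≈⟨ ↑-+ u′ v′ p′ pu′ pv′ ⟨
    (u′ ∪+ v′) ↑ p′       ∎)
    where
    open import Relation.Binary.Reasoning.Setoid ≈ᴹ-setoid
    uv uv′ : ℕ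
    uv = stage (u ∪+ v)
    uv′ = stage (u′ ∪+ v′)
    p : uv ≤′ uv ⊔ℕ uv′
    p = m≤′m⊔n uv uv′
    p′ : uv′ ≤′ uv ⊔ℕ uv′
    p′ = n≤′m⊔n uv uv′
    pu : stage u ≤′ uv ⊔ℕ uv′
    pu = ≤′-trans (m≤′m⊔n (stage u) (stage v)) p
    pv : stage v ≤′ uv ⊔ℕ uv′
    pv = ≤′-trans (n≤′m⊔n (stage u) (stage v)) p
    pu′ : stage u′ ≤′ uv ⊔ℕ uv′
    pu′ = ≤′-trans (m≤′m⊔n (stage u′) (stage v′)) p′
    pv′ : stage v′ ≤′ uv ⊔ℕ uv′
    pv′ = ≤′-trans (n≤′m⊔n (stage u′) (stage v′)) p′

  ∪--cong : ∀ {u v} → u ≈∪ v → ∪- u ≈∪ ∪- v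
  ∪--cong {u} {v} (agreeAt p q u≈v) =
    agreeAt p q (≈ᴹ-trans (↑-neg u p) (≈ᴹ-trans (-ᴹ‿cong u≈v) (≈ᴹ-sym (↑-neg v q))))

  ∪*-cong : ∀ {s t u v} → s ≈ t → u ≈∪ v → s ∪* u ≈∪ t ∪* v
  ∪*-cong {s} {t} {u} {v} s≈t (agreeAt p q u≈v) =
    agreeAt p q (≈ᴹ-trans (↑-* s u p) (≈ᴹ-trans (*ₗ-cong s≈t u≈v) (≈ᴹ-sym (↑-* t v q))))

  ∪+-assoc : ∀ u v w → (u ∪+ v) ∪+ w ≈∪ u ∪+ (v ∪+ w)
  ∪+-assoc u v w = agreeAt pL pR (begin
    ((u ∪+ v) ∪+ w) ↑ pL          ≈⟨ ↑-+ (u ∪+ v) w pL puv pw ⟩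
    (u ∪+ v) ↑ puv +ᴹ w ↑ pw      ≈⟨ +ᴹ-congʳ (↑-+ u v puv pu pv) ⟩
    (u ↑ pu +ᴹ v ↑ pv) +ᴹ w ↑ pw  ≈⟨ +ᴹ-assoc _ _ _ ⟩
    u ↑ pu +ᴹ (v ↑ pv +ᴹ w ↑ pw)  ≈⟨ +ᴹ-congˡ (↑-+ v w pvw pv pw) ⟨
    u ↑ pu +ᴹ (v ∪+ w) ↑ pvw      ≈⟨ ↑-+ u (v ∪+ w) pR pu pvw ⟨
    (u ∪+ (v ∪+ w)) ↑ pR          ∎)
    where
    open import Relation.Binary.Reasoning.Setoid ≈ᴹ-setoid
    L R′ : ℕ
    L = stage ((u ∪+ v) ∪+ w)
    R′ = stage (u ∪+ (v ∪+ w))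
    pL : L ≤′ L ⊔ℕ R′
    pL = m≤′m⊔n L R′
    pR : R′ ≤′ L ⊔ℕ R′
    pR = n≤′m⊔n L R′
    puv : stage (u ∪+ v) ≤′ L ⊔ℕ R′
    puv = ≤′-trans (m≤′m⊔n (stage (u ∪+ v)) (stage w)) pL
    pw : stage w ≤′ L ⊔ℕ R′
    pw = ≤′-trans (n≤′m⊔n (stage (u ∪+ v)) (stage w)) pL
    pu : stage u ≤′ L ⊔ℕ R′
    pu = ≤′-trans (m≤′m⊔n (stage u) (stage v)) puv
    pv : stage v ≤′ L ⊔ℕ R′
    pv = ≤′-trans (n≤′m⊔n (stage u) (stage v)) puv
    pvw : stage (v ∪+ w) ≤′ L ⊔ℕ R′
    pvw = ≤′-trans (n≤′m⊔n (stage u) (stage (v ∪+ w))) pR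

  ∪+-comm : ∀ u v → u ∪+ v ≈∪ v ∪+ u
  ∪+-comm u v = agreeAt p p′ (begin
    (u ∪+ v) ↑ p      ≈⟨ ↑-+ u v p pu pv ⟩
    u ↑ pu +ᴹ v ↑ pv  ≈⟨ +ᴹ-comm _ _ ⟩
    v ↑ pv +ᴹ u ↑ pu  ≈⟨ ↑-+ v u p′ pv pu ⟨
    (v ∪+ u) ↑ p′     ∎)
    where
    open import Relation.Binary.Reasoning.Setoid ≈ᴹ-setoid
    uv vu : ℕ
    uv = stage (u ∪+ v)
    vu = stage (v ∪+ u)
    p : uv ≤′ uv ⊔ℕ vu
    p = m≤′m⊔n uv vu
    p′ : vu ≤′ uv ⊔ℕ vu
    p′ = n≤′m⊔n uv vu
    pu : stage u ≤′ uv ⊔ℕ vu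
    pu = ≤′-trans (m≤′m⊔n (stage u) (stage v)) p
    pv : stage v ≤′ uv ⊔ℕ vu
    pv = ≤′-trans (n≤′m⊔n (stage u) (stage v)) p

  ∪+-identityˡ : ∀ u → ∪0 ∪+ u ≈∪ u
  ∪+-identityˡ u = agreeAt ≤′-refl ≤′-refl
    (≈ᴹ-trans (↑-+ ∪0 u ≤′-refl z≤′n ≤′-refl) (≈ᴹ-trans (+ᴹ-congʳ (↑-0 z≤′n)) (+ᴹ-identityˡ _)))

  ∪+-identityʳ : ∀ u → u ∪+ ∪0 ≈∪ u
  ∪+-identityʳ u = agreeAt ≤′-refl p
    (≈ᴹ-trans (↑-+ u ∪0 ≤′-refl p z≤′n) (≈ᴹ-trans (+ᴹ-congˡ (↑-0 z≤′n)) (+ᴹ-identityʳ _)))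
    where
    p : stage u ≤′ stage u ⊔ℕ 0
    p = m≤′m⊔n (stage u) 0

  ∪--inverseˡ : ∀ u → (∪- u) ∪+ u ≈∪ ∪0
  ∪--inverseˡ u = agreeAt ≤′-refl z≤′n (begin
    ((∪- u) ∪+ u) ↑ ≤′-refl  ≈⟨ ↑-+ (∪- u) u ≤′-refl p p ⟩
    (∪- u) ↑ p +ᴹ u ↑ p      ≈⟨ +ᴹ-congʳ (↑-neg u p) ⟩
    -ᴹ (u ↑ p) +ᴹ u ↑ p      ≈⟨ -ᴹ‿inverseˡ _ ⟩
    0ᴹ                       ≈⟨ ↑-0 z≤′n ⟨
    ∪0 ↑ z≤′n                ∎)
    where
    open import Relation.Binary.Reasoning.Setoid ≈ᴹ-setoid
    p : stage u ≤′ stage u ⊔ℕ stage u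
    p = m≤′m⊔n (stage u) (stage u)

  ∪--inverseʳ : ∀ u → u ∪+ (∪- u) ≈∪ ∪0
  ∪--inverseʳ u = ≈∪-trans (∪+-comm u (∪- u)) (∪--inverseˡ u)

  ∪*-zeroˡ : ∀ u → 0# ∪* u ≈∪ ∪0
  ∪*-zeroˡ u = agreeAt ≤′-refl z≤′n (≈ᴹ-trans (*ₗ-zeroˡ _) (≈ᴹ-sym (↑-0 z≤′n)))

  ∪*-zeroʳ : ∀ s → s ∪* ∪0 ≈∪ ∪0
  ∪*-zeroʳ s = agreeAt ≤′-refl ≤′-refl (*ₗ-zeroʳ s)

  ∪*-identityˡ : ∀ u → 1# ∪* u ≈∪ u
  ∪*-identityˡ u = agreeAt ≤′-refl ≤′-refl (*ₗ-identityˡ _)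

  ∪*-assoc : ∀ s t u → (s * t) ∪* u ≈∪ s ∪* t ∪* u
  ∪*-assoc s t u = agreeAt ≤′-refl ≤′-refl (*ₗ-assoc s t _)

  ∪*-distribˡ : ∀ s u v → s ∪* (u ∪+ v) ≈∪ s ∪* u ∪+ s ∪* v
  ∪*-distribˡ s u v = agreeAt ≤′-refl ≤′-refl (≈ᴹ-trans (*ₗ-distribˡ s _ _)
    (+ᴹ-cong (≈ᴹ-sym (↑-* s u (m≤′m⊔n (stage u) (stage v)))) (≈ᴹ-sym (↑-* s v (n≤′m⊔n (stage u) (stage v))))))

  ∪*-distribʳ : ∀ u s t → (s + t) ∪* u ≈∪ s ∪* u ∪+ t ∪* u
  ∪*-distribʳ u s t = agreeAt p ≤′-refl (begin
    ((s + t) ∪* u) ↑ p            ≈⟨ ↑-* (s + t) u p ⟩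
    (s + t) *ₗ (u ↑ p)            ≈⟨ *ₗ-distribʳ _ s t ⟩
    s *ₗ (u ↑ p) +ᴹ t *ₗ (u ↑ p)  ≈⟨ +ᴹ-cong (↑-* s u p) (↑-* t u p) ⟨
    (s ∪* u) ↑ p +ᴹ (t ∪* u) ↑ p  ≡⟨ ≡.cong ((s ∪* u) ↑ p +ᴹ_) (↑-irrelevant (t ∪* u) p p′) ⟩
    (s ∪* u ∪+ t ∪* u) ↑ ≤′-refl  ∎)
    where
    open import Relation.Binary.Reasoning.Setoid ≈ᴹ-setoid
    p p′ : stage u ≤′ stage u ⊔ℕ stage u
    p = m≤′m⊔n (stage u) (stage u)
    p′ = n≤′m⊔n (stage u) (stage u)

  unionModule : Module R a ℓ
  unionModule = record
    { Carrierᴹ = Union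
    ; _≈ᴹ_     = _≈∪_
    ; _+ᴹ_     = _∪+_
    ; _*ₗ_     = _∪*_
    ; _*ᵣ_     = flip _∪*_
    ; 0ᴹ       = ∪0
    ; -ᴹ_      = ∪-_
    ; isModule = IsModuleFromLeft.isModule {commutativeRing = R} record
      { isLeftModule = record
        { isLeftSemimodule = record
          { +ᴹ-isCommutativeMonoid = record
            { isMonoid = record
              { isSemigroup = record
                { isMagma = record
                  { isEquivalence = record { refl = ≈∪-refl ; sym = ≈∪-sym ; trans = ≈∪-trans }
                  ; ∙-cong        = ∪+-cong
                  }
                ; assoc = ∪+-assoc
                }
              ; identity = ∪+-identityˡ , ∪+-identityʳ
              }
            ; comm = ∪+-comm
            }
          ; isPreleftSemimodule = record
            { *ₗ-cong      = ∪*-cong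
            ; *ₗ-zeroˡ     = ∪*-zeroˡ
            ; *ₗ-distribʳ  = ∪*-distribʳ
            ; *ₗ-identityˡ = ∪*-identityˡ
            ; *ₗ-assoc     = ∪*-assoc
            ; *ₗ-zeroʳ     = ∪*-zeroʳ
            ; *ₗ-distribˡ  = ∪*-distribˡ
            }
          }
        ; -ᴹ‿cong    = ∪--cong
        ; -ᴹ‿inverse = ∪--inverseˡ , ∪--inverseʳ
        }
      }
    }

  at-isModuleMonomorphism : ∀ s → IsModuleMonomorphism (rawModule {s}) (Module.rawModule unionModule) (at s)
  at-isModuleMonomorphism s = record
    { isModuleHomomorphism = record
      { isBimoduleHomomorphism = record
        { +ᴹ-isGroupHomomorphism = record
          { isMonoidHomomorphism = record
            { isMagmaHomomorphism = record
              { isRelHomomorphism = record { cong = agreeAt ≤′-refl ≤′-refl }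
              ; homo = λ x y → agreeAt p ≤′-refl
                  (≈ᴹ-trans (Lift.+ᴹ-homo p x y) (+ᴹ-congˡ (≈ᴹ-reflexive (lift-irrelevant p p′ y))))
              }
            ; ε-homo = agreeAt ≤′-refl z≤′n (≈ᴹ-sym (↑-0 z≤′n))
            }
          ; ⁻¹-homo = λ x → ≈∪-refl
          }
        ; *ₗ-homo = λ r x → ≈∪-refl
        ; *ᵣ-homo = λ r x → agreeAt ≤′-refl ≤′-refl (≈ᴹ-sym (*ₗ-*ᵣ-coincident r x))
        }
      }
    ; injective = λ x≈y → agree-anywhere x≈y ≤′-refl ≤′-refl
    }
    where
    p p′ : s ≤′ s ⊔ℕ s
    p = m≤′m⊔n s s
    p′ = n≤′m⊔n s s

  at-↑ : ∀ u {t} (p : stage u ≤′ t) → at t (u ↑ p) ≈∪ u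
  at-↑ u p = agreeAt ≤′-refl p ≈ᴹ-refl

  at-next : ∀ {s} (x : Carrierᴹ {s}) → at (suc s) (next x) ≈∪ at s x
  at-next x = agreeAt ≤′-refl (≤′-step ≤′-refl) ≈ᴹ-refl

⨆ : ∀ {k} → Vector ℕ k → ℕ
⨆ {zero}  _  = 0
⨆ {suc k} ns = ns zero ⊔ℕ ⨆ (ns ∘ suc)

≤′-⨆ : ∀ {k} (ns : Vector ℕ k) i → ns i ≤′ ⨆ ns
≤′-⨆ ns zero    = m≤′m⊔n (ns zero) (⨆ (ns ∘ suc))
≤′-⨆ ns (suc i) = ≤′-trans (≤′-⨆ (ns ∘ suc) i) (n≤′m⊔n (ns zero) (⨆ (ns ∘ suc)))

-- The saturation of a module

module Saturation {r ℓr m ℓm} {R : CommutativeRing r ℓr} (N : Module R m ℓm) where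
  open CommutativeRing R using () renaming (Carrier to Scalar)

  L : Level
  L = r ⊔ ℓr ⊔ m ⊔ ℓm

  tower : ℕ → Module R L L
  tower zero    = AdjoinSolutions.M⁺ N
  tower (suc s) = AdjoinSolutions.M⁺ (tower s)

  open DirectedUnion tower (λ {s} → AdjoinSolutions.embed (tower s))
                           (λ {s} → AdjoinSolutions.embed-isModuleMonomorphism (tower s)) public
  open Module unionModule using () renaming (+ᴹ-monoid to ∪-monoid)
  open MonoidSum ∪-monoid using () renaming (sum to sum∪; sum-cong-≋ to sum∪-cong)
  private
    module At s = IsModuleMonomorphism (at-isModuleMonomorphism s)
    module Tower s = Module (tower s)
    module AdjoinAt s = AdjoinSolutions (tower s)

  embedding : Module.Carrierᴹ N → Union
  embedding = at 0 ∘ AdjoinSolutions.embed N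

  embedding-isModuleMonomorphism :
    IsModuleMonomorphism (Module.rawModule N) (Module.rawModule unionModule) embedding
  embedding-isModuleMonomorphism = Composition.isModuleMonomorphism ≈∪-trans
    (AdjoinSolutions.embed-isModuleMonomorphism N) (at-isModuleMonomorphism 0)

  at-linearCombination : ∀ {k S} (c : Vector Scalar k) (u : Vector Union k) →
                         (p : ∀ i → Union.stage (u i) ≤′ S) →
                         at S (MonoidSum.sum (Tower.+ᴹ-monoid S) (λ i → Tower._*ₗ_ S (c i) (u i ↑ p i)))
                         ≈∪ sum∪ (λ i → c i ∪* u i)
  at-linearCombination {S = S} c u p = ≈∪-trans
    (sum-homo (Tower.+ᴹ-monoid S) ∪-monoid (At.+ᴹ-homo S) (At.0ᴹ-homo S) (λ i → Tower._*ₗ_ S (c i) (u i ↑ p i)))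
    (sum∪-cong (λ i → ∪*-cong (CommutativeRing.refl R) (at-↑ (u i) (p i))))

  unionModule-solvesCompatibleSystems : SolvesCompatibleSystems unionModule
  unionModule-solvesCompatibleSystems k f u compatible = at (suc S) (AdjoinAt.solution S σ) , solves
    where
    S : ℕ
    S = ⨆ (λ i → Union.stage (u i))
    p : ∀ i → Union.stage (u i) ≤′ S
    p = ≤′-⨆ (λ i → Union.stage (u i))
    σ : AdjoinAt.System S
    σ = record
      { lhs        = f
      ; rhs        = λ i → u i ↑ p i
      ; compatible = λ t t·f≈0 → At.injective S
          (≈∪-trans (at-linearCombination t u p) (≈∪-trans (compatible t t·f≈0) (≈∪-sym (At.0ᴹ-homo S))))
      }
    solves : ∀ i → f i ∪* at (suc S) (AdjoinAt.solution S σ) ≈∪ u i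
    solves i = ≈∪-trans (At.⟦⟧-cong (suc S) (AdjoinAt.solution-solves S σ i))
                        (≈∪-trans (at-next (u i ↑ p i)) (at-↑ (u i) (p i)))

  unionModule-hasGenericAnnihilatedElements : HasGenericAnnihilatedElements unionModule
  unionModule-hasGenericAnnihilatedElements k f l g notInIdeal d U = v , annihilated , outside
    where
    S : ℕ
    S = ⨆ (λ i → ⨆ (λ j → Union.stage (U i j)))
    p : ∀ i j → Union.stage (U i j) ≤′ S
    p i j = ≤′-trans (≤′-⨆ (λ j → Union.stage (U i j)) j)
                     (≤′-⨆ (λ i → ⨆ (λ j → Union.stage (U i j))) i)
    σ : AdjoinAt.System S
    σ = record
      { lhs        = f
      ; rhs        = λ _ → Tower.0ᴹ S
      ; compatible = λ t _ → sum-zero (Tower.+ᴹ-monoid S) (λ i → Tower.*ₗ-zeroʳ S (t i))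
      }
    v : Union
    v = at (suc S) (AdjoinAt.solution S σ)
    annihilated : ∀ j → f j ∪* v ≈∪ ∪0
    annihilated j = ≈∪-trans (At.⟦⟧-cong (suc S) (AdjoinAt.solution-solves S σ j))
                             (≈∪-trans (at-next (Tower.0ᴹ S)) (At.0ᴹ-homo S))
    outside : ∀ i → ¬ InSpan unionModule (U i) (g i ∪* v)
    outside i (c , g·v≈Σ) = notInIdeal i (AdjoinAt.embedded-multiple⇒InIdeal S σ (g i) w
      (At.injective (suc S)
        (≈∪-trans g·v≈Σ (≈∪-trans (≈∪-sym (at-linearCombination c (U i) (p i))) (≈∪-sym (at-next w))))))
      where
      w : Tower.Carrierᴹ S
      w = MonoidSum.sum (Tower.+ᴹ-monoid S) (λ j → Tower._*ₗ_ S (c j) (U i j ↑ p i j))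

mainTheorem10 : ∀ {c ℓ ℓI m ℓm : Level} (K : Field c ℓ) (n : ℕ)
                  (I : ZPoly n → Set ℓI) → IsIdeal I
                  → (N : Module (𝔸 K n I) m ℓm)
                  → Σ[ M' ∈ Module (𝔸 K n I) (c ⊔ ℓ ⊔ ℓI ⊔ m ⊔ ℓm) (c ⊔ ℓ ⊔ ℓI ⊔ m ⊔ ℓm) ]
                    Σ[ h ∈ (Module.Carrierᴹ N → Module.Carrierᴹ M') ]
                    (ModuleMorphisms.IsModuleMonomorphism (Module.rawModule N) (Module.rawModule M') h
                     × CondI K n M' × CondII K n M')
mainTheorem10 K n I _ N =
  unionModule , embedding , embedding-isModuleMonomorphism , unionModule-solvesCompatibleSystems , generic
  where
  open Saturation N
  generic : CondII K n unionModule
  generic k f l g notInIdeal d U =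
    let v , annihilated , outside = unionModule-hasGenericAnnihilatedElements k f l g notInIdeal d U
    in  v , annihilated , λ i (λs , g·v∈span) → outside i ((λ j → ι K n {I = I} (λs j)) , g·v∈span)
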